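{- Let $p>10$ be a prime. For real $a<b$ write $\big(\frac{\prod}{p}\big)(a,b)=\prod_{x\in\mathbb Z,\ a<x<b}\big(\frac{x}{p}\big)$, and let $\#N_p(3)$ be the number of quadratic non-residues modulo $p$ among the integers in $(p/6,p/3)$. Then $$(-1)^{\#N_p(3)}=\Big(\frac{\prod}{p}\Big)(p/6,p/3)=\begin{cases}\big(\frac{2}{p}\big)\big(\frac{\prod}{p}\big)(0,p/3) & p\equiv1\pmod{12},\\ \big(\frac{\prod}{p}\big)(0,p/3) & p\equiv5\pmod{12},\\ -\big(\frac{\prod}{p}\big)(p/3,p/2) & p\equiv7\pmod{12},\\ \big(\frac{2}{p}\big)\big(\frac{\prod}{p}\big)(p/3,p/2) & p\equiv11\pmod{12}.\end{cases}$$
   Context: $\big(\frac{\cdot}{p}\big)$ is the Legendre symbol. -}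

module Defs where

open import Data.Bool using (Bool; if_then_else_)
open import Data.Nat as ℕ using (ℕ; zero; suc)
open import Data.Integer as ℤ using (ℤ; +_; -[1+_]; _%ℕ_)
open import Data.Rational using (ℚ; floor; ceiling)
open import Data.List using (List; map; upTo; filterᵇ; length; foldr)
open import Data.Bool.ListAction using (any)
open import Relation.Nullary using (does)

-- Legendre symbol (x / p), valued in {0, 1, -1} ⊆ ℤ:
--   0 if p ∣ x, 1 if x is a nonzero square mod p, -1 otherwise.
-- (Only meaningful for p an odd prime; p = 0 gives a junk value.)
legendre : ℕ → ℤ → ℤ
legendre zero    x = + 0
legendre (suc q) x =
  if (x %ℕ suc q) ℕ.≡ᵇ 0 then + 0
  else if any (λ y → ((y ℕ.* y) ℕ.% suc q) ℕ.≡ᵇ (x %ℕ suc q)) (upTo (suc q))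
       then + 1 else ℤ.- (+ 1)

natPart : ℤ → ℕ
natPart (+ n)    = n
natPart -[1+ _ ] = 0

-- the list of all integers x with a < x < b  (i.e. ⌊a⌋+1, …, ⌈b⌉-1)
intsBetween : ℚ → ℚ → List ℤ
intsBetween a b =
  map (λ i → floor a ℤ.+ + 1 ℤ.+ + i)
      (upTo (natPart (ceiling b ℤ.- floor a ℤ.- + 1)))

legProd : ℕ → ℚ → ℚ → ℤ
legProd p a b = foldr ℤ._*_ (+ 1) (map (legendre p) (intsBetween a b))

numNonRes : ℕ → ℚ → ℚ → ℕ
numNonRes p a b =
  length (filterᵇ (λ x → does (legendre p x ℤ.≟ ℤ.- (+ 1))) (intsBetween a b))

#N3 : ℕ → ℕ
#N3 p = numNonRes p (+ p Data.Rational./ 6) (+ p Data.Rational./ 3)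

{-# OPTIONS --safe #-}

-- Write χ for the Legendre symbol, h = (p - 1)/2, and B = (p/6, p/3), C = (p/3, p/2) for the
-- integers in these intervals.  Doubling x ↦ 2x for x < p/4 and folding x ↦ p - 2x for x > p/4
-- map B bijectively onto C, so, as χ is multiplicative by Euler's criterion χ(x) ≡ x^h,
--   ∏_C χ = χ(-1)^#(p/4, p/3) · χ(2)^#B · ∏_B χ.
-- The same folding of (0, p/2) onto itself gives χ(2) = (-1)^#(p/4, p/2), and χ(-1) = (-1)^h.
-- When p ≡ 1 (mod 4), Wilson's theorem ((h!)² ≡ -1) gives ∏_(0,p/2) χ = (-1)^(h/2), which trades
-- ∏_C χ for ∏_(0,p/3) χ.  In each residue class of p modulo 12 all these exponents are explicit
-- polynomials in p div 12, and their parities give the four cases.  Euler's criterion and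
-- Wilson's theorem both come from pairing every unit x with a·x⁻¹.  Finally each χ(x) with
-- x ∈ B is ±1, so ∏_B χ = (-1)^#N₃.

module Submission where

open import Defs
open import Data.Nat using (ℕ; _<_; _%_)
open import Data.Nat.Primality using (Prime)
open import Data.Integer using (ℤ; +_; -_; _*_; _^_)
open import Data.Rational using (_/_)
open import Data.Product using (_×_)
open import Relation.Binary.PropositionalEquality using (_≡_)

open import Data.Bool using (true; false; T)
open import Data.Bool.ListAction using (any)
open import Data.Empty using (⊥-elim)
open import Data.Integer as ℤ using (_+_; _-_; -[1+_]; 1ℤ; -1ℤ)
open import Data.Integer.Divisibility.Signed
  using (_∣_; divides; ∣m∣n⇒∣m+n; ∣m⇒∣-m; ∣m⇒∣m*n; ∣n⇒∣m*n; ∣⇒∣ᵤ; ∣ᵤ⇒∣)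
import Data.Integer.DivMod as ℤDM
import Data.Integer.Properties as ℤP
open import Data.Integer.Tactic.RingSolver using (solve-∀)
open import Data.List using (List; []; _∷_; _++_; foldr; length; map; upTo; applyUpTo; filterᵇ)
open import Data.List.Membership.Propositional using (_∈_; find; lose)
open import Data.List.Membership.Propositional.Properties using (∈-∃++; ∈-map⁻; ∈-++⁻; ∈-upTo⁺)
open import Data.List.Membership.Propositional.Properties.WithK using (unique∧set⇒bag)
open import Data.List.Properties using (length-map; length-++; map-∘; map-++; map-upTo; ++-assoc)
open import Data.List.Relation.Binary.BagAndSetEquality using (∼bag⇒↭)
open import Data.List.Relation.Binary.Permutation.Propositional using (_↭_; ↭⇒↭ₛ; ↭-prep; ↭-sym; ↭-trans)
open import Data.List.Relation.Binary.Permutation.Propositional.Properties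
  using (∈-resp-↭; ↭-length) renaming (shift to ↭-shift)
open import Data.List.Relation.Binary.Permutation.Setoid.Properties using (foldr-commMonoid; Unique-resp-↭)
open import Data.List.Relation.Binary.Subset.Propositional using (_⊆_)
open import Data.List.Relation.Unary.All as All using (All)
import Data.List.Relation.Unary.AllPairs as AllPairs
open import Data.List.Relation.Unary.Any using (here; there)
open import Data.List.Relation.Unary.Any.Properties using (any⁺; any⁻)
open import Data.List.Relation.Unary.Unique.Propositional using (Unique)
import Data.List.Relation.Unary.Unique.Propositional.Properties as Unique
open import Data.Nat as ℕ using (zero; suc; z≤n; s≤s; _≤_)
open import Data.Nat.Coprimality using (Coprime; prime⇒coprime; coprime-Bézout)
import Data.Nat.Divisibility as ℕDiv
import Data.Nat.DivMod as ℕDM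
open import Data.Nat.GCD using (module Bézout)
open import Data.Nat.Primality using (euclidsLemma; prime⇒nonZero; prime⇒nonTrivial)
import Data.Nat.Properties as ℕP
import Data.Nat.Tactic.RingSolver as ℕSolver
open import Data.Product using (∃; _,_; proj₁; proj₂)
open import Data.Rational using (floor; ceiling)
import Data.Rational.Properties as ℚP
open import Data.Sum as Sum using (_⊎_; inj₁; inj₂; [_,_]′)
open import Data.Unit using (tt)
open import Function.Bundles using (mk⇔)
open import Relation.Binary.Bundles using (Setoid)
open import Relation.Binary.PropositionalEquality
  using (_≢_; refl; sym; trans; cong; cong₂; subst; setoid; module ≡-Reasoning)
import Relation.Binary.Reasoning.Setoid as SetoidReasoning
open import Relation.Nullary using (¬_; yes; no; does; contradiction)

product : List ℤ → ℤ
product = foldr _*_ 1ℤ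

product-++ : ∀ xs ys → product (xs ++ ys) ≡ product xs * product ys
product-++ []       ys = sym (ℤP.*-identityˡ (product ys))
product-++ (x ∷ xs) ys = trans (cong (x *_) (product-++ xs ys)) (sym (ℤP.*-assoc x _ _))

product-↭ : ∀ {xs ys} → xs ↭ ys → product xs ≡ product ys
product-↭ xs↭ys = foldr-commMonoid (setoid ℤ) ℤP.*-1-isCommutativeMonoid (↭⇒↭ₛ xs↭ys)

product-map-* : ∀ c xs → product (map (c *_) xs) ≡ c ^ length xs * product xs
product-map-* c []       = sym (ℤP.*-identityʳ 1ℤ)
product-map-* c (x ∷ xs) =
  trans (cong (c * x *_) (product-map-* c xs)) (interchange c x (c ^ length xs) (product xs))
  where
  interchange : ∀ a b c d → (a * b) * (c * d) ≡ (a * c) * (b * d)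
  interchange = solve-∀

module _ {A : Set} where

  ∈-∃↭ : ∀ {x : A} {ys} → x ∈ ys → ∃ λ zs → ys ↭ x ∷ zs
  ∈-∃↭ {x} x∈ys with ∈-∃++ x∈ys
  ... | as , bs , refl = as ++ bs , ↭-shift x as bs

  unique-↭ : ∀ {xs ys : List A} → xs ↭ ys → Unique xs → Unique ys
  unique-↭ xs↭ys = Unique-resp-↭ (setoid A) (↭⇒↭ₛ xs↭ys)

  ⊆-length⇒⊇ : ∀ {xs ys : List A} → Unique xs → xs ⊆ ys → length ys ≤ length xs → ys ⊆ xs
  ⊆-length⇒⊇ {[]} {[]} _ _ _ ()
  ⊆-length⇒⊇ {x ∷ xs} {ys} (x∉xs AllPairs.∷ uxs) xs⊆ys ∣ys∣≤ y∈ys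
    with zs , ys↭x∷zs ← ∈-∃↭ (xs⊆ys (here refl))
    with ∈-resp-↭ ys↭x∷zs y∈ys
  ... | here y≡x  = here y≡x
  ... | there y∈zs = there (⊆-length⇒⊇ uxs xs⊆zs ∣zs∣≤ y∈zs)
    where
    xs⊆zs : xs ⊆ zs
    xs⊆zs {z} z∈xs with ∈-resp-↭ ys↭x∷zs (xs⊆ys (there z∈xs))
    ... | here z≡x   = ⊥-elim (All.lookup x∉xs z∈xs (sym z≡x))
    ... | there z∈zs = z∈zs
    ∣zs∣≤ : length zs ≤ length xs
    ∣zs∣≤ = ℕ.s≤s⁻¹ (subst (ℕ._≤ suc (length xs)) (↭-length ys↭x∷zs) ∣ys∣≤)

  unique-⊆-length⇒↭ : ∀ {xs ys : List A} → Unique xs → Unique ys →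
                      xs ⊆ ys → length ys ≤ length xs → xs ↭ ys
  unique-⊆-length⇒↭ uxs uys xs⊆ys ∣ys∣≤ =
    ∼bag⇒↭ (unique∧set⇒bag uxs uys (mk⇔ xs⊆ys (⊆-length⇒⊇ uxs xs⊆ys ∣ys∣≤)))

range : ℕ → ℕ → List ℤ
range s zero    = []
range s (suc n) = + s ∷ range (suc s) n

length-range : ∀ s n → length (range s n) ≡ n
length-range s zero    = refl
length-range s (suc n) = cong suc (length-range (suc s) n)

range-++ : ∀ s m n → range s (m ℕ.+ n) ≡ range s m ++ range (s ℕ.+ m) n
range-++ s zero    n = cong (λ t → range t n) (sym (ℕP.+-identityʳ s))
range-++ s (suc m) n = cong (+ s ∷_) (trans (range-++ (suc s) m n)
                         (cong (λ t → range (suc s) m ++ range t n) (sym (ℕP.+-suc s m))))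

∈-range⁺ : ∀ {s n m} → s ≤ m → m < s ℕ.+ n → + m ∈ range s n
∈-range⁺ {s} {zero}  s≤m m<s+0 = contradiction s≤m (ℕP.<⇒≱ (subst (_ <_) (ℕP.+-identityʳ s) m<s+0))
∈-range⁺ {s} {suc n} {m} s≤m m<s+n with m ℕ.≟ s
... | yes refl = here refl
... | no  m≢s  = there (∈-range⁺ (ℕP.≤∧≢⇒< s≤m (λ s≡m → m≢s (sym s≡m)))
                                  (subst (m <_) (ℕP.+-suc s n) m<s+n))

∈-range⁻ : ∀ {s n z} → z ∈ range s n → ∃ λ m → z ≡ + m × s ≤ m × m < s ℕ.+ n
∈-range⁻ {s} {suc n} (here refl) = s , refl , ℕP.≤-refl , ℕP.m<m+n s (s≤s z≤n)
∈-range⁻ {s} {suc n} (there z∈) with ∈-range⁻ z∈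
... | m , refl , s<m , m<s+n = m , refl , ℕP.<⇒≤ s<m , subst (m <_) (sym (ℕP.+-suc s n)) m<s+n

range-unique : ∀ s n → Unique (range s n)
range-unique s zero    = AllPairs.[]
range-unique s (suc n) = All.tabulate s∉ AllPairs.∷ range-unique (suc s) n
  where
  s∉ : ∀ {z} → z ∈ range (suc s) n → + s ≢ z
  s∉ z∈ s≡z with ∈-range⁻ z∈
  ... | m , refl , s<m , _ = ℕP.<⇒≢ s<m (ℤP.+-injective s≡z)

applyUpTo≡range : ∀ (f : ℕ → ℤ) s n → (∀ i → f i ≡ + (s ℕ.+ i)) → applyUpTo f n ≡ range s n
applyUpTo≡range f s zero    f≗ = refl
applyUpTo≡range f s (suc n) f≗ = cong₂ _∷_ (trans (f≗ 0) (cong +_ (ℕP.+-identityʳ s)))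
  (applyUpTo≡range (λ i → f (suc i)) (suc s) n (λ i → trans (f≗ (suc i)) (cong +_ (ℕP.+-suc s i))))

intsBetween≡range : ∀ {a b} s n → floor a ≡ + s → ceiling b ≡ + suc (s ℕ.+ n) →
                    intsBetween a b ≡ range (suc s) n
intsBetween≡range {a} {b} s n ⌊a⌋≡s ⌈b⌉≡ rewrite ⌊a⌋≡s | ⌈b⌉≡ = begin
  map (λ i → + s + + 1 + + i) (upTo (natPart (+ suc (s ℕ.+ n) ℤ.- + s ℤ.- + 1)))
    ≡⟨ cong (λ m → map (λ i → + s + + 1 + + i) (upTo (natPart m))) ∣B∣ ⟩
  map (λ i → + s + + 1 + + i) (upTo n)
    ≡⟨ map-upTo _ n ⟩
  applyUpTo (λ i → + s + + 1 + + i) n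
    ≡⟨ applyUpTo≡range _ (suc s) n (λ i → cong (ℤ._+ + i) (ℤP.+-comm (+ s) (+ 1))) ⟩
  range (suc s) n ∎
  where
  open ≡-Reasoning
  shift : ∀ s n → + 1 + (s + n) ℤ.- s ℤ.- + 1 ≡ n
  shift = solve-∀
  ∣B∣ : + suc (s ℕ.+ n) ℤ.- + s ℤ.- + 1 ≡ + n
  ∣B∣ = trans (cong (λ t → + 1 + t ℤ.- + s ℤ.- + 1) (ℤP.pos-+ s n)) (shift (+ s) (+ n))

[r+q*d]/d≡q : ∀ {r q d} .{{_ : ℕ.NonZero d}} → r < d → (r ℕ.+ q ℕ.* d) ℕ./ d ≡ q
[r+q*d]/d≡q {r} {q} {d} r<d = begin
  (r ℕ.+ q ℕ.* d) ℕ./ d      ≡⟨ ℕDM.+-distrib-/ r (q ℕ.* d) (subst (_< d) (sym rem) r<d) ⟩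
  r ℕ./ d ℕ.+ q ℕ.* d ℕ./ d  ≡⟨ cong₂ ℕ._+_ (ℕDM.m<n⇒m/n≡0 r<d) (ℕDM.m*n/n≡m q d) ⟩
  q                          ∎
  where
  open ≡-Reasoning
  rem : r ℕ.% d ℕ.+ (q ℕ.* d) ℕ.% d ≡ r
  rem = trans (cong₂ ℕ._+_ (ℕDM.m<n⇒m%n≡m r<d) (ℕDM.m*n%n≡0 q d)) (ℕP.+-identityʳ r)

floor-/ : ∀ {p q r d} → .(Coprime p (suc d)) → p ≡ r ℕ.+ q ℕ.* suc d → r < suc d →
          floor (+ p / suc d) ≡ + q
floor-/ {p} c refl r<d =
  trans (cong floor (ℚP.normalize-coprime c)) (trans (ℤP.*-identityˡ _) (cong +_ ([r+q*d]/d≡q r<d)))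

ceiling-/ : ∀ {p q r d} → .(Coprime p (suc d)) → p ≡ suc r ℕ.+ q ℕ.* suc d → suc r < suc d →
            ceiling (+ p / suc d) ≡ + suc q
ceiling-/ {p} {q} {r} {d} c refl r<d =
  trans (cong ceiling (ℚP.normalize-coprime c))
        (cong ℤ.-_ (trans (ℤP.*-identityˡ _)
          (trans (neg-div (trans (ℕDM.[m+kn]%n≡m%n (suc r) q (suc d)) (ℕDM.m<n⇒m%n≡m r<d)))
                 (cong -[1+_] ([r+q*d]/d≡q r<d)))))
  where
  neg-div : ∀ {m s} → suc m ℕ.% suc d ≡ suc s → -[1+ m ] ℤ./ℕ suc d ≡ -[1+ suc m ℕ./ suc d ]
  neg-div e rewrite e = refl

^-distribʳ-* : ∀ a b n → (a * b) ^ n ≡ a ^ n * b ^ n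
^-distribʳ-* a b zero    = refl
^-distribʳ-* a b (suc n) =
  trans (cong ((a * b) *_) (^-distribʳ-* a b n)) (interchange a b (a ^ n) (b ^ n))
  where
  interchange : ∀ a b c d → (a * b) * (c * d) ≡ (a * c) * (b * d)
  interchange = solve-∀

^-comm : ∀ a m n → (a ^ m) ^ n ≡ (a ^ n) ^ m
^-comm a m n = trans (ℤP.^-*-assoc a m n) (trans (cong (a ^_) (ℕP.*-comm m n)) (sym (ℤP.^-*-assoc a n m)))

IsSign : ℤ → Set
IsSign z = z ≡ 1ℤ ⊎ z ≡ -1ℤ

sign-* : ∀ {a b} → IsSign a → IsSign b → IsSign (a * b)
sign-* (inj₁ refl) (inj₁ refl) = inj₁ refl
sign-* (inj₁ refl) (inj₂ refl) = inj₂ refl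
sign-* (inj₂ refl) (inj₁ refl) = inj₂ refl
sign-* (inj₂ refl) (inj₂ refl) = inj₁ refl

sign-^ : ∀ {a} n → IsSign a → IsSign (a ^ n)
sign-^ zero    _  = inj₁ refl
sign-^ (suc n) ±a = sign-* ±a (sign-^ n ±a)

sign-square : ∀ {a} → IsSign a → a * a ≡ 1ℤ
sign-square (inj₁ refl) = refl
sign-square (inj₂ refl) = refl

sign-^-even : ∀ {a} n → IsSign a → a ^ (n ℕ.+ n) ≡ 1ℤ
sign-^-even {a} n ±a = begin
  a ^ (n ℕ.+ n)   ≡⟨ ℤP.^-distribˡ-+-* a n n ⟩
  a ^ n * a ^ n   ≡⟨ ^-distribʳ-* a a n ⟨
  (a * a) ^ n     ≡⟨ cong (_^ n) (sign-square ±a) ⟩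
  1ℤ ^ n          ≡⟨ ℤP.^-zeroˡ n ⟩
  1ℤ              ∎
  where open ≡-Reasoning

-1^-parity : ∀ {e} r q → e ≡ r ℕ.+ (q ℕ.+ q) → -1ℤ ^ e ≡ -1ℤ ^ r
-1^-parity r q refl = begin
  -1ℤ ^ (r ℕ.+ (q ℕ.+ q))        ≡⟨ ℤP.^-distribˡ-+-* -1ℤ r (q ℕ.+ q) ⟩
  -1ℤ ^ r * -1ℤ ^ (q ℕ.+ q)      ≡⟨ cong (-1ℤ ^ r *_) (sign-^-even q (inj₂ refl)) ⟩
  -1ℤ ^ r * 1ℤ                   ≡⟨ ℤP.*-identityʳ (-1ℤ ^ r) ⟩
  -1ℤ ^ r                        ∎
  where open ≡-Reasoning

sign-flip : ∀ {σ x y} → IsSign σ → σ * x ≡ y → x ≡ σ * y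
sign-flip {σ} {x} {y} ±σ σx≡y = begin
  x              ≡⟨ ℤP.*-identityˡ x ⟨
  1ℤ * x         ≡⟨ cong (_* x) (sign-square ±σ) ⟨
  σ * σ * x      ≡⟨ ℤP.*-assoc σ σ x ⟩
  σ * (σ * x)    ≡⟨ cong (σ *_) σx≡y ⟩
  σ * y          ∎
  where open ≡-Reasoning

sign-count : ∀ (f : ℤ → ℤ) xs → All (λ x → IsSign (f x)) xs →
             -1ℤ ^ length (filterᵇ (λ x → does (f x ℤ.≟ -1ℤ)) xs) ≡ product (map f xs)
sign-count f []       All.[]               = refl
sign-count f (x ∷ xs) (inj₁ fx≡1 All.∷ ±f)  rewrite fx≡1  =
  trans (sign-count f xs ±f) (sym (ℤP.*-identityˡ _))
sign-count f (x ∷ xs) (inj₂ fx≡-1 All.∷ ±f) rewrite fx≡-1 = cong (-1ℤ *_) (sign-count f xs ±f)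

-- Congruences modulo p

module Congruence (p : ℕ) where

  infix 4 _≈_
  record _≈_ (a b : ℤ) : Set where
    constructor mk≈
    field p∣a-b : + p ∣ a - b
  open _≈_ public

  ≈-by : ∀ {a b} k → a - b ≡ k * + p → a ≈ b
  ≈-by k eq = mk≈ (divides k eq)

  ≈-refl : ∀ {a} → a ≈ a
  ≈-refl {a} = ≈-by (+ 0) (ℤP.+-inverseʳ a)

  ≈-reflexive : ∀ {a b} → a ≡ b → a ≈ b
  ≈-reflexive refl = ≈-refl

  ≈-sym : ∀ {a b} → a ≈ b → b ≈ a
  ≈-sym {a} {b} (mk≈ d) = mk≈ (subst (+ p ∣_) (flip a b) (∣m⇒∣-m d))
    where
    flip : ∀ a b → - (a - b) ≡ b - a
    flip = solve-∀

  ≈-trans : ∀ {a b c} → a ≈ b → b ≈ c → a ≈ c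
  ≈-trans {a} {b} {c} (mk≈ d) (mk≈ e) = mk≈ (subst (+ p ∣_) (telescope a b c) (∣m∣n⇒∣m+n d e))
    where
    telescope : ∀ a b c → (a - b) + (b - c) ≡ a - c
    telescope = solve-∀

  ≈-setoid : Setoid _ _
  ≈-setoid = record { Carrier = ℤ ; _≈_ = _≈_
                    ; isEquivalence = record { refl = ≈-refl ; sym = ≈-sym ; trans = ≈-trans } }

  module ≈-Reasoning = SetoidReasoning ≈-setoid

  *-cong : ∀ {a b c d} → a ≈ b → c ≈ d → a * c ≈ b * d
  *-cong {a} {b} {c} {d} (mk≈ e) (mk≈ f) =
    mk≈ (subst (+ p ∣_) (split a b c d) (∣m∣n⇒∣m+n (∣m⇒∣m*n c e) (∣n⇒∣m*n b f)))
    where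
    split : ∀ a b c d → (a - b) * c + b * (c - d) ≡ a * c - b * d
    split = solve-∀

  *-congˡ : ∀ c {a b} → a ≈ b → c * a ≈ c * b
  *-congˡ c a≈b = *-cong (≈-refl {c}) a≈b

  *-congʳ : ∀ c {a b} → a ≈ b → a * c ≈ b * c
  *-congʳ c a≈b = *-cong a≈b (≈-refl {c})

  ^-cong : ∀ {a b} n → a ≈ b → a ^ n ≈ b ^ n
  ^-cong zero    _   = ≈-refl
  ^-cong (suc n) a≈b = *-cong a≈b (^-cong n a≈b)

  -‿cong : ∀ {a b} → a ≈ b → - a ≈ - b
  -‿cong {a} {b} a≈b = ≈-trans (≈-reflexive (sym (ℤP.-1*i≡-i a)))
                         (≈-trans (*-congˡ -1ℤ a≈b) (≈-reflexive (ℤP.-1*i≡-i b)))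

  product-map-≈ : ∀ {f g : ℤ → ℤ} xs → (∀ x → f x ≈ g x) → product (map f xs) ≈ product (map g xs)
  product-map-≈ []       f≈g = ≈-refl
  product-map-≈ (x ∷ xs) f≈g = *-cong (f≈g x) (product-map-≈ xs f≈g)

  product-pairing : ∀ (a : ℤ) (f : ℤ → ℤ) n xs → Unique xs → length xs ≡ n ℕ.+ n →
                    (∀ {x} → x ∈ xs → f x ∈ xs) → (∀ {x} → x ∈ xs → f x ≢ x) →
                    (∀ {x} → x ∈ xs → f (f x) ≡ x) → (∀ {x} → x ∈ xs → x * f x ≈ a) →
                    product xs ≈ a ^ n
  product-pairing a f zero    []       _   _     _      _       _     _    = ≈-refl
  product-pairing a f (suc n) (x ∷ xs) uxs ∣x∷xs∣ closed fixless invol pair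
    with closed (here refl)
  ... | here fx≡x = ⊥-elim (fixless (here refl) fx≡x)
  ... | there fx∈xs
    with zs , xs↭fx∷zs ← ∈-∃↭ fx∈xs
    with x∉ AllPairs.∷ fx∉ AllPairs.∷ uzs ← unique-↭ (↭-prep x xs↭fx∷zs) uxs = begin
      x * product xs          ≡⟨ cong (x *_) (product-↭ xs↭fx∷zs) ⟩
      x * (f x * product zs)  ≡⟨ ℤP.*-assoc x (f x) (product zs) ⟨
      x * f x * product zs    ≈⟨ *-cong (pair (here refl)) IH ⟩
      a * a ^ n               ∎
    where
    open ≈-Reasoning
    zs⊆ : ∀ {z} → z ∈ zs → z ∈ x ∷ xs
    zs⊆ z∈zs = there (∈-resp-↭ (↭-sym xs↭fx∷zs) (there z∈zs))
    ∣zs∣ : length zs ≡ n ℕ.+ n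
    ∣zs∣ = ℕP.suc-injective (trans (sym (↭-length xs↭fx∷zs))
             (ℕP.suc-injective (trans ∣x∷xs∣ (cong suc (ℕP.+-suc n n)))))
    closed-zs : ∀ {z} → z ∈ zs → f z ∈ zs
    closed-zs {z} z∈zs with closed (zs⊆ z∈zs)
    ... | here fz≡x = ⊥-elim (All.lookup fx∉ z∈zs (trans (cong f (sym fz≡x)) (invol (zs⊆ z∈zs))))
    ... | there fz∈xs with ∈-resp-↭ xs↭fx∷zs fz∈xs
    ...   | here fz≡fx = ⊥-elim (All.lookup x∉ (there z∈zs)
                           (trans (sym (invol (here refl))) (trans (cong f (sym fz≡fx)) (invol (zs⊆ z∈zs)))))
    ...   | there fz∈zs = fz∈zs
    IH : product zs ≈ a ^ n
    IH = product-pairing a f n zs uzs ∣zs∣ closed-zs (λ z∈ → fixless (zs⊆ z∈))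
           (λ z∈ → invol (zs⊆ z∈)) (λ z∈ → pair (zs⊆ z∈))

module PrimeModulus (p : ℕ) (prime : Prime p) where

  open Congruence p public

  instance
    p≢0 : ℕ.NonZero p
    p≢0 = prime⇒nonZero prime

  Nonzero : ℤ → Set
  Nonzero a = ¬ (+ p ∣ a)

  euclid : ∀ a b → + p ∣ a * b → + p ∣ a ⊎ + p ∣ b
  euclid a b p∣ab = Sum.map ∣ᵤ⇒∣ ∣ᵤ⇒∣
    (euclidsLemma ℤ.∣ a ∣ ℤ.∣ b ∣ prime (subst (p ℕDiv.∣_) (ℤP.abs-* a b) (∣⇒∣ᵤ p∣ab)))

  nonzero-* : ∀ {a b} → Nonzero a → Nonzero b → Nonzero (a * b)
  nonzero-* {a} {b} a≢0 b≢0 p∣ab = [ a≢0 , b≢0 ]′ (euclid a b p∣ab)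

  nonzero-≈ : ∀ {a b} → a ≈ b → Nonzero a → Nonzero b
  nonzero-≈ {a} {b} (mk≈ p∣a-b) a≢0 p∣b = a≢0 (subst (+ p ∣_) (undo a b) (∣m∣n⇒∣m+n p∣a-b p∣b))
    where
    undo : ∀ a b → (a - b) + b ≡ a
    undo = solve-∀

  nonzero-< : ∀ {m} → 0 < m → m < p → Nonzero (+ m)
  nonzero-< {suc m} _ m<p p∣m = ℕP.<⇒≱ m<p (ℕDiv.∣⇒≤ (∣⇒∣ᵤ p∣m))

  cancelʳ : ∀ {a b c} → a * c ≈ b * c → Nonzero c → a ≈ b
  cancelʳ {a} {b} {c} (mk≈ p∣ac-bc) c≢0 =
    [ mk≈ , (λ p∣c → ⊥-elim (c≢0 p∣c)) ]′ (euclid (a - b) c (subst (+ p ∣_) (factor a b c) p∣ac-bc))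
    where
    factor : ∀ a b c → a * c - b * c ≡ (a - b) * c
    factor = solve-∀

  square-roots : ∀ {x y} → x * x ≈ y * y → x ≈ y ⊎ x ≈ - y
  square-roots {x} {y} (mk≈ p∣) =
    Sum.map mk≈ (λ p∣x+y → mk≈ (subst (+ p ∣_) (plus x y) p∣x+y))
            (euclid (x - y) (x + y) (subst (+ p ∣_) (difference-of-squares x y) p∣))
    where
    difference-of-squares : ∀ x y → x * x - y * y ≡ (x - y) * (x + y)
    difference-of-squares = solve-∀
    plus : ∀ x y → x + y ≡ x - - y
    plus = solve-∀

  ≈-mod : ∀ a → a ≈ + (a ℤ.%ℕ p)
  ≈-mod a = ≈-by (a ℤ./ℕ p)
    (trans (cong (_- + (a ℤ.%ℕ p)) (ℤDM.a≡a%ℕn+[a/ℕn]*n a p)) (cancel (+ (a ℤ.%ℕ p)) (a ℤ./ℕ p * + p)))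
    where
    cancel : ∀ r q → (r + q) - r ≡ q
    cancel = solve-∀

  private
    ≈⇒≡-≥ : ∀ {m n} → n ≤ m → m < p → + m ≈ + n → m ≡ n
    ≈⇒≡-≥ {m} {n} n≤m m<p (mk≈ p∣m-n) = ℕP.≤-antisym (ℕP.m∸n≡0⇒m≤n m∸n≡0) n≤m
      where
      p∣m∸n : p ℕDiv.∣ m ℕ.∸ n
      p∣m∸n = ∣⇒∣ᵤ (subst (+ p ∣_) (trans (ℤP.m-n≡m⊖n m n) (ℤP.⊖-≥ n≤m)) p∣m-n)
      m∸n≡0 : m ℕ.∸ n ≡ 0
      m∸n≡0 = trans (sym (ℕDM.m<n⇒m%n≡m (ℕP.≤-<-trans (ℕP.m∸n≤m m n) m<p)))
                    (ℕDiv.n∣m⇒m%n≡0 _ p p∣m∸n)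

  ≈⇒≡ : ∀ {m n} → m < p → n < p → + m ≈ + n → m ≡ n
  ≈⇒≡ {m} {n} m<p n<p m≈n with ℕP.≤-total n m
  ... | inj₁ n≤m = ≈⇒≡-≥ n≤m m<p m≈n
  ... | inj₂ m≤n = sym (≈⇒≡-≥ m≤n n<p (≈-sym m≈n))

-- Wilson's theorem and Euler's criterion

odd-prime>2 : ∀ h → Prime (suc (h ℕ.+ h)) → 2 < suc (h ℕ.+ h)
odd-prime>2 zero    pr = contradiction (ℕ.nonTrivial⇒n>1 1 {{prime⇒nonTrivial pr}}) (ℕP.<-irrefl refl)
odd-prime>2 (suc h) _  = s≤s (s≤s (ℕP.≤-trans (s≤s z≤n) (ℕP.m≤n+m (suc h) h)))

pred-halves : ∀ {l} h → suc (suc l) ≡ h ℕ.+ h → ∃ λ h′ → h ≡ suc h′ × l ≡ h′ ℕ.+ h′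
pred-halves (suc h′) eq = h′ , refl , ℕP.suc-injective (trans (ℕP.suc-injective eq) (ℕP.+-suc h′ h′))

module OddPrime (p h : ℕ) (p≡1+2h : p ≡ suc (h ℕ.+ h)) (prime : Prime p) where

  open PrimeModulus p prime public

  2<p : 2 < p
  2<p = subst (2 <_) (sym p≡1+2h) (odd-prime>2 h (subst Prime p≡1+2h prime))

  private
    <p⇒<1+2h : ∀ {m} → m < p → m < suc (h ℕ.+ h)
    <p⇒<1+2h = subst (_ <_) p≡1+2h

  sign-≈⇒≡ : ∀ {a b} → IsSign a → IsSign b → a ≈ b → a ≡ b
  sign-≈⇒≡ (inj₁ refl) (inj₁ refl) _ = refl
  sign-≈⇒≡ (inj₁ refl) (inj₂ refl) 1≈-1 = ⊥-elim (nonzero-< (s≤s z≤n) 2<p (p∣a-b 1≈-1))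
  sign-≈⇒≡ (inj₂ refl) (inj₁ refl) -1≈1 = ⊥-elim (nonzero-< (s≤s z≤n) 2<p (p∣a-b (≈-sym -1≈1)))
  sign-≈⇒≡ (inj₂ refl) (inj₂ refl) _ = refl

  U : List ℤ
  U = range 1 (h ℕ.+ h)

  ∈U⇒nonzero : ∀ {x} → x ∈ U → Nonzero x
  ∈U⇒nonzero x∈U with ∈-range⁻ x∈U
  ... | m , refl , 1≤m , m<1+2h = nonzero-< 1≤m (subst (m <_) (sym p≡1+2h) m<1+2h)

  ∈U-≈⇒≡ : ∀ {x y} → x ∈ U → y ∈ U → x ≈ y → x ≡ y
  ∈U-≈⇒≡ x∈U y∈U x≈y with ∈-range⁻ x∈U | ∈-range⁻ y∈U
  ... | m , refl , _ , m<1+2h | n , refl , _ , n<1+2h =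
    cong +_ (≈⇒≡ (subst (m <_) (sym p≡1+2h) m<1+2h) (subst (n <_) (sym p≡1+2h) n<1+2h) x≈y)

  residue : ℤ → ℤ
  residue c = + (c ℤ.%ℕ p)

  residue-≈ : ∀ c → residue c ≈ c
  residue-≈ c = ≈-sym (≈-mod c)

  residue≢0 : ∀ {c} → Nonzero c → 0 < c ℤ.%ℕ p
  residue≢0 {c} c≢0 with c ℤ.%ℕ p | ≈-mod c
  ... | zero  | c≈0 = ⊥-elim (c≢0 (subst (+ p ∣_) (ℤP.+-identityʳ c) (p∣a-b c≈0)))
  ... | suc _ | _   = s≤s z≤n

  residue∈U : ∀ {c} → Nonzero c → residue c ∈ U
  residue∈U {c} c≢0 = ∈-range⁺ (residue≢0 c≢0) (<p⇒<1+2h (ℤDM.n%ℕd<d c p))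

  private
    pos-+-* : ∀ a b c d e → a ℕ.+ b ℕ.* c ≡ d ℕ.* e → + a + + b * + c ≡ + d * + e
    pos-+-* a b c d e eq = begin
      + a + + b * + c    ≡⟨ cong (λ t → + a + t) (ℤP.pos-* b c) ⟨
      + a + + (b ℕ.* c)  ≡⟨ ℤP.pos-+ a (b ℕ.* c) ⟨
      + (a ℕ.+ b ℕ.* c)    ≡⟨ cong +_ eq ⟩
      + (d ℕ.* e)          ≡⟨ ℤP.pos-* d e ⟩
      + d * + e            ∎
      where open ≡-Reasoning

  bezout-inverse : ∀ {m} → Bézout.Identity 1 p m → ∃ λ n → + m * n ≈ 1ℤ
  bezout-inverse {m} (Bézout.Identity.+- x y eq) = - + y , ≈-by (- + x) (begin
    + m * - + y - + 1        ≡⟨ rearrange (+ m) (+ y) ⟩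
    - (+ 1 + + y * + m)    ≡⟨ cong -_ (pos-+-* 1 y m x p eq) ⟩
    - (+ x * + p)            ≡⟨ ℤP.neg-distribˡ-* (+ x) (+ p) ⟩
    - + x * + p              ∎)
    where
    open ≡-Reasoning
    rearrange : ∀ m y → m * - y - + 1 ≡ - (+ 1 + y * m)
    rearrange = solve-∀
  bezout-inverse {m} (Bézout.Identity.-+ x y eq) = + y , ≈-by (+ x) (begin
    + m * + y - + 1              ≡⟨ rearrange (+ m) (+ y) ⟩
    + y * + m - + 1              ≡⟨ cong (_- + 1) (pos-+-* 1 x p y m eq) ⟨
    + 1 + + x * + p - + 1      ≡⟨ cancel (+ x * + p) ⟩
    + x * + p                    ∎)
    where
    open ≡-Reasoning
    rearrange : ∀ m y → m * y - + 1 ≡ y * m - + 1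
    rearrange = solve-∀
    cancel : ∀ a → + 1 + a - + 1 ≡ a
    cancel = solve-∀

  private
    inverse-< : ∀ m → m < p → ℤ
    inverse-< zero    _   = + 0
    inverse-< (suc m) m<p = proj₁ (bezout-inverse (coprime-Bézout (prime⇒coprime prime m<p)))

    inverse-<-spec : ∀ m (m<p : m < p) → 0 < m → + m * inverse-< m m<p ≈ 1ℤ
    inverse-<-spec (suc m) m<p _ = proj₂ (bezout-inverse (coprime-Bézout (prime⇒coprime prime m<p)))

  inverse : ℤ → ℤ
  inverse c = inverse-< (c ℤ.%ℕ p) (ℤDM.n%ℕd<d c p)

  inverse-spec : ∀ {c} → Nonzero c → c * inverse c ≈ 1ℤ
  inverse-spec {c} c≢0 =
    ≈-trans (*-congʳ (inverse c) (≈-mod c)) (inverse-<-spec _ (ℤDM.n%ℕd<d c p) (residue≢0 c≢0))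

  χ : ℤ → ℤ
  χ = legendre p

  ∏χ : List ℤ → ℤ
  ∏χ xs = product (map χ xs)

  IsSquare : ℤ → Set
  IsSquare a = ∃ λ y → y * y ≈ a

  module Partner (a : ℤ) (a≢0 : Nonzero a) where

    opaque
      partner : ℤ → ℤ
      partner x = residue (a * inverse x)

    *-a*inverse : ∀ {x} → x ∈ U → x * (a * inverse x) ≈ a
    *-a*inverse {x} x∈U = begin
      x * (a * inverse x)  ≡⟨ swap x a (inverse x) ⟩
      a * (x * inverse x)  ≈⟨ *-congˡ a (inverse-spec (∈U⇒nonzero x∈U)) ⟩
      a * 1ℤ               ≡⟨ ℤP.*-identityʳ a ⟩
      a                    ∎
      where
      open ≈-Reasoning
      swap : ∀ x a y → x * (a * y) ≡ a * (x * y)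
      swap = solve-∀

    opaque
      unfolding partner

      partner-* : ∀ {x} → x ∈ U → x * partner x ≈ a
      partner-* {x} x∈U = ≈-trans (*-congˡ x (residue-≈ (a * inverse x))) (*-a*inverse x∈U)

      partner∈U : ∀ {x} → x ∈ U → partner x ∈ U
      partner∈U {x} x∈U = residue∈U λ p∣ → nonzero-≈ (≈-sym (*-a*inverse x∈U)) a≢0 (∣n⇒∣m*n x p∣)

    partner-involutive : ∀ {x} → x ∈ U → partner (partner x) ≡ x
    partner-involutive {x} x∈U = ∈U-≈⇒≡ (partner∈U (partner∈U x∈U)) x∈U (cancelʳ
      (≈-trans (≈-reflexive (ℤP.*-comm (partner (partner x)) (partner x)))
               (≈-trans (partner-* (partner∈U x∈U)) (≈-sym (partner-* x∈U))))
      (∈U⇒nonzero (partner∈U x∈U)))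

    fixed⇒square : ∀ {x} → x ∈ U → partner x ≡ x → x * x ≈ a
    fixed⇒square {x} x∈U px≡x = subst (λ t → x * t ≈ a) px≡x (partner-* x∈U)

    square⇒fixed : ∀ {x} → x ∈ U → x * x ≈ a → partner x ≡ x
    square⇒fixed {x} x∈U x²≈a = ∈U-≈⇒≡ (partner∈U x∈U) x∈U (cancelʳ
      (≈-trans (≈-reflexive (ℤP.*-comm (partner x) x)) (≈-trans (partner-* x∈U) (≈-sym x²≈a)))
      (∈U⇒nonzero x∈U))

    product-U-nonsquare : ¬ IsSquare a → product U ≈ a ^ h
    product-U-nonsquare nonsquare =
      product-pairing a partner h U (range-unique 1 (h ℕ.+ h)) (length-range 1 (h ℕ.+ h))
        partner∈U (λ {x} x∈U px≡x → nonsquare (x , fixed⇒square x∈U px≡x)) partner-involutive partner-*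

    -- If a ≡ m², the only units fixed by the pairing are m and p - m; the others pair up.
    module SquareRoot (m : ℕ) (0<m : 0 < m) (m<p : m < p) (m²≈a : + m * + m ≈ a) where

      y z : ℤ
      y = + m
      z = + (p ℕ.∸ m)

      y∈U : y ∈ U
      y∈U = ∈-range⁺ 0<m (<p⇒<1+2h m<p)

      z∈U : z ∈ U
      z∈U = ∈-range⁺ (ℕP.m<n⇒0<n∸m m<p) (<p⇒<1+2h (ℕP.∸-monoʳ-< 0<m (ℕP.<⇒≤ m<p)))

      z≡p-y : z ≡ + p - y
      z≡p-y = sym (trans (ℤP.m-n≡m⊖n p m) (ℤP.⊖-≥ (ℕP.<⇒≤ m<p)))

      z≈-y : z ≈ - y
      z≈-y = ≈-by (+ 1) (trans (cong (λ t → t - - y) z≡p-y) (cancel (+ p) y))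
        where
        cancel : ∀ p y → (p - y) - - y ≡ + 1 * p
        cancel = solve-∀

      z²≈a : z * z ≈ a
      z²≈a = ≈-trans (*-cong z≈-y z≈-y) (≈-trans (≈-reflexive (neg-square y)) m²≈a)
        where
        neg-square : ∀ y → - y * - y ≡ y * y
        neg-square = solve-∀

      z≢y : z ≢ y
      z≢y z≡y = ∈U⇒nonzero y∈U p∣y
        where
        y≈-y : y ≈ - y
        y≈-y = subst (_≈ - y) z≡y z≈-y
        p∣y : + p ∣ y
        p∣y = [ (λ p∣2 → ⊥-elim (nonzero-< (s≤s z≤n) 2<p p∣2)) , (λ p∣y → p∣y) ]′
                (euclid (+ 2) y (subst (+ p ∣_) (double y) (p∣a-b y≈-y)))
          where
          double : ∀ y → y - - y ≡ + 2 * y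
          double = solve-∀

      U-splits : ∃ λ ws → U ↭ y ∷ z ∷ ws
      U-splits with ys , U↭y∷ys ← ∈-∃↭ y∈U with ∈-resp-↭ U↭y∷ys z∈U
      ... | here z≡y    = ⊥-elim (z≢y z≡y)
      ... | there z∈ys with ws , ys↭z∷ws ← ∈-∃↭ z∈ys = ws , ↭-trans U↭y∷ys (↭-prep y ys↭z∷ws)

      module _ {ws} (U↭y∷z∷ws : U ↭ y ∷ z ∷ ws) where

        unique-y∷z∷ws : Unique (y ∷ z ∷ ws)
        unique-y∷z∷ws = unique-↭ U↭y∷z∷ws (range-unique 1 (h ℕ.+ h))

        ws⊆U : ∀ {w} → w ∈ ws → w ∈ U
        ws⊆U w∈ws = ∈-resp-↭ (↭-sym U↭y∷z∷ws) (there (there w∈ws))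

        ws∌y : ∀ {w} → w ∈ ws → w ≢ y
        ws∌y w∈ws w≡y = All.lookup (AllPairs.head unique-y∷z∷ws) (there w∈ws) (sym w≡y)

        ws∌z : ∀ {w} → w ∈ ws → w ≢ z
        ws∌z w∈ws w≡z = All.lookup (AllPairs.head (AllPairs.tail unique-y∷z∷ws)) w∈ws (sym w≡z)

        partner-hits-fixed : ∀ {v w} → v * v ≈ a → v ∈ U → w ∈ U → partner w ≡ v → w ≡ v
        partner-hits-fixed v²≈a v∈U w∈U pw≡v =
          trans (sym (partner-involutive w∈U)) (trans (cong partner pw≡v) (square⇒fixed v∈U v²≈a))

        closed : ∀ {w} → w ∈ ws → partner w ∈ ws
        closed w∈ws with ∈-resp-↭ U↭y∷z∷ws (partner∈U (ws⊆U w∈ws))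
        ... | here pw≡y           = ⊥-elim (ws∌y w∈ws (partner-hits-fixed m²≈a y∈U (ws⊆U w∈ws) pw≡y))
        ... | there (here pw≡z)   = ⊥-elim (ws∌z w∈ws (partner-hits-fixed z²≈a z∈U (ws⊆U w∈ws) pw≡z))
        ... | there (there pw∈ws) = pw∈ws

        fixless : ∀ {w} → w ∈ ws → partner w ≢ w
        fixless {w} w∈ws pw≡w =
          [ (λ w≈y → ws∌y w∈ws (∈U-≈⇒≡ (ws⊆U w∈ws) y∈U w≈y))
          , (λ w≈-y → ws∌z w∈ws (∈U-≈⇒≡ (ws⊆U w∈ws) z∈U (≈-trans w≈-y (≈-sym z≈-y)))) ]′
          (square-roots (≈-trans (fixed⇒square (ws⊆U w∈ws) pw≡w) (≈-sym m²≈a)))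

      product-U : product U ≈ - (a ^ h)
      product-U with ws , U↭y∷z∷ws ← U-splits
                with h′ , h≡1+h′ , ∣ws∣ ← pred-halves h
                                           (trans (sym (↭-length U↭y∷z∷ws)) (length-range 1 (h ℕ.+ h))) =
        begin
        product U             ≡⟨ product-↭ U↭y∷z∷ws ⟩
        y * (z * product ws)  ≈⟨ *-congˡ y (*-cong z≈-y product-ws) ⟩
        y * (- y * a ^ h′)    ≡⟨ rearrange y (a ^ h′) ⟩
        - (y * y) * a ^ h′    ≈⟨ *-congʳ (a ^ h′) (-‿cong m²≈a) ⟩
        - a * a ^ h′          ≡⟨ ℤP.neg-distribˡ-* a (a ^ h′) ⟨
        - (a * a ^ h′)        ≡⟨ cong (λ n → - (a ^ n)) h≡1+h′ ⟨
        - (a ^ h)             ∎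
        where
        open ≈-Reasoning
        rearrange : ∀ y b → y * (- y * b) ≡ - (y * y) * b
        rearrange = solve-∀
        product-ws : product ws ≈ a ^ h′
        product-ws = product-pairing a partner h′ ws (AllPairs.tail (AllPairs.tail (unique-y∷z∷ws U↭y∷z∷ws)))
          ∣ws∣ (closed U↭y∷z∷ws) (fixless U↭y∷z∷ws)
          (λ w∈ws → partner-involutive (ws⊆U U↭y∷z∷ws w∈ws)) (λ w∈ws → partner-* (ws⊆U U↭y∷z∷ws w∈ws))

    product-U-square : IsSquare a → product U ≈ - (a ^ h)
    product-U-square (y , y²≈a) = SquareRoot.product-U (y ℤ.%ℕ p) (residue≢0 y≢0) (ℤDM.n%ℕd<d y p)
                                    (≈-trans (*-cong (residue-≈ y) (residue-≈ y)) y²≈a)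
      where
      y≢0 : Nonzero y
      y≢0 p∣y = nonzero-≈ (≈-sym y²≈a) a≢0 (∣m⇒∣m*n y p∣y)

  1≢0 : Nonzero 1ℤ
  1≢0 = nonzero-< (s≤s z≤n) (ℕP.<-trans (ℕP.n<1+n 1) 2<p)

  wilson : product U ≈ -1ℤ
  wilson = ≈-trans (Partner.product-U-square 1ℤ 1≢0 (1ℤ , ≈-refl)) (≈-reflexive (cong -_ (ℤP.^-zeroˡ h)))

  euler-square : ∀ {a} → Nonzero a → IsSquare a → a ^ h ≈ 1ℤ
  euler-square {a} a≢0 square = begin
    a ^ h          ≡⟨ ℤP.neg-involutive (a ^ h) ⟨
    - - (a ^ h)    ≈⟨ -‿cong (≈-trans (≈-sym (Partner.product-U-square a a≢0 square)) wilson) ⟩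
    - -1ℤ          ∎
    where open ≈-Reasoning

  euler-nonsquare : ∀ {a} → Nonzero a → ¬ IsSquare a → a ^ h ≈ -1ℤ
  euler-nonsquare {a} a≢0 nonsquare = ≈-trans (≈-sym (Partner.product-U-nonsquare a a≢0 nonsquare)) wilson

  ≈⇒%≡ : ∀ {a b} → a ≈ b → a ℤ.%ℕ p ≡ b ℤ.%ℕ p
  ≈⇒%≡ {a} {b} a≈b = ≈⇒≡ (ℤDM.n%ℕd<d a p) (ℤDM.n%ℕd<d b p) (≈-trans (residue-≈ a) (≈-trans a≈b (≈-mod b)))

  χ-spec : ∀ {x} → Nonzero x → χ x ≡ 1ℤ × IsSquare x ⊎ χ x ≡ -1ℤ × ¬ IsSquare x
  χ-spec {x} x≢0 = unfold p≡1+2h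
    where
    -- legendre only computes once its modulus is a successor.
    unfold : p ≡ suc (h ℕ.+ h) → χ x ≡ 1ℤ × IsSquare x ⊎ χ x ≡ -1ℤ × ¬ IsSquare x
    unfold refl with x ℤ.%ℕ p in x%p | residue≢0 x≢0
    ... | suc r | _ with any (λ y → (y ℕ.* y) ℕ.% p ℕ.≡ᵇ suc r) (upTo p) in any≡
    ...   | true  = inj₁ (refl , square)
      where
      square : IsSquare x
      square with y , _ , y²≡x ← find (any⁻ (λ y → (y ℕ.* y) ℕ.% p ℕ.≡ᵇ suc r) (upTo p) (subst T (sym any≡) tt))
        = + y , (begin
          + y * + y            ≡⟨ ℤP.pos-* y y ⟨
          + (y ℕ.* y)          ≈⟨ ≈-mod (+ (y ℕ.* y)) ⟩
          + ((y ℕ.* y) ℕ.% p)  ≡⟨ cong +_ (trans (ℕP.≡ᵇ⇒≡ ((y ℕ.* y) ℕ.% p) (suc r) y²≡x) (sym x%p)) ⟩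
          residue x            ≈⟨ residue-≈ x ⟩
          x                    ∎)
        where open ≈-Reasoning
    ...   | false = inj₂ (refl , nonsquare)
      where
      nonsquare : ¬ IsSquare x
      nonsquare (y , y²≈x) = subst T any≡ (any⁺ (λ y → (y ℕ.* y) ℕ.% p ℕ.≡ᵇ suc r)
        (lose (∈-upTo⁺ (ℤDM.n%ℕd<d y p)) (ℕP.≡⇒≡ᵇ ((m ℕ.* m) ℕ.% p) (suc r) m²≡x)))
        where
        m = y ℤ.%ℕ p
        m²≡x : (m ℕ.* m) ℕ.% p ≡ suc r
        m²≡x = trans (≈⇒%≡ (≈-trans (≈-reflexive (ℤP.pos-* m m))
                                    (≈-trans (*-cong (residue-≈ y) (residue-≈ y)) y²≈x))) x%p

  euler-criterion : ∀ {x} → Nonzero x → χ x ≈ x ^ h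
  euler-criterion x≢0 =
    [ (λ (χ≡1 , square) → ≈-trans (≈-reflexive χ≡1) (≈-sym (euler-square x≢0 square)))
    , (λ (χ≡-1 , nonsquare) → ≈-trans (≈-reflexive χ≡-1) (≈-sym (euler-nonsquare x≢0 nonsquare))) ]′
    (χ-spec x≢0)

  χ-sign : ∀ {x} → Nonzero x → IsSign (χ x)
  χ-sign x≢0 = Sum.map proj₁ proj₁ (χ-spec x≢0)

  ∏χ-≈ : ∀ {xs} → All Nonzero xs → ∏χ xs ≈ product xs ^ h
  ∏χ-≈ All.[]                   = ≈-reflexive (sym (ℤP.^-zeroˡ h))
  ∏χ-≈ {x ∷ xs} (x≢0 All.∷ xs≢0) =
    ≈-trans (*-cong (euler-criterion x≢0) (∏χ-≈ xs≢0)) (≈-reflexive (sym (^-distribʳ-* x (product xs) h)))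

  ∏χ-sign : ∀ {xs} → All Nonzero xs → IsSign (∏χ xs)
  ∏χ-sign All.[]           = inj₁ refl
  ∏χ-sign (x≢0 All.∷ xs≢0) = sign-* (χ-sign x≢0) (∏χ-sign xs≢0)

  range-nonzero : ∀ {s n} → 0 < s → s ℕ.+ n ≤ p → All Nonzero (range s n)
  range-nonzero {s} {n} 0<s s+n≤p = All.tabulate nonzero
    where
    nonzero : ∀ {x} → x ∈ range s n → Nonzero x
    nonzero x∈ with m , refl , s≤m , m<s+n ← ∈-range⁻ x∈ =
      nonzero-< (ℕP.<-≤-trans 0<s s≤m) (ℕP.<-≤-trans m<s+n s+n≤p)

  product-nonzero : ∀ {xs} → All Nonzero xs → Nonzero (product xs)
  product-nonzero All.[]           = 1≢0
  product-nonzero (x≢0 All.∷ xs≢0) = nonzero-* x≢0 (product-nonzero xs≢0)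

  2≢0 : Nonzero (+ 2)
  2≢0 = nonzero-< (s≤s z≤n) 2<p

-- Gauss's folding

module Folding (p h : ℕ) (p≡1+2h : p ≡ suc (h ℕ.+ h)) (prime : Prime p) where

  open OddPrime p h p≡1+2h prime public

  private
    1+h+m≤p : ∀ {m} → m ≤ h → suc h ℕ.+ m ≤ p
    1+h+m≤p m≤h = subst (_ ≤_) (sym p≡1+2h) (s≤s (ℕP.+-monoʳ-≤ h m≤h))

  p-∈-range : ∀ {c n q} → c ℕ.+ q ≤ p → p < c ℕ.+ n ℕ.+ q → + p - + q ∈ range c n
  p-∈-range {c} {n} {q} c+q≤p p<c+n+q = subst (_∈ range c n) p∸q≡ (∈-range⁺ c≤p∸q p∸q<c+n)
    where
    q≤p : q ≤ p
    q≤p = ℕP.m+n≤o⇒n≤o c c+q≤p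
    p∸q≡ : + (p ℕ.∸ q) ≡ + p - + q
    p∸q≡ = sym (trans (ℤP.m-n≡m⊖n p q) (ℤP.⊖-≥ q≤p))
    c≤p∸q : c ≤ p ℕ.∸ q
    c≤p∸q = ℕP.m+n≤o⇒m≤o∸n c c+q≤p
    p∸q<c+n : p ℕ.∸ q < c ℕ.+ n
    p∸q<c+n = subst (_≤ c ℕ.+ n) (ℕP.+-∸-assoc 1 q≤p)
                (ℕP.m≤n+o⇒m∸n≤o (suc p) q (subst (suc p ≤_) (ℕP.+-comm (c ℕ.+ n) q) p<c+n+q))

  double reflect : ℤ → ℤ
  double x = + 2 * x
  reflect x = + p - + 2 * x

  double-injective : ∀ {x y} → double x ≡ double y → x ≡ y
  double-injective {x} {y} = ℤP.*-cancelˡ-≡ (+ 2) x y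

  reflect-injective : ∀ {x y} → reflect x ≡ reflect y → x ≡ y
  reflect-injective {x} {y} eq =
    double-injective (trans (undo (+ p) x) (trans (cong (λ t → + p - t) eq) (sym (undo (+ p) y))))
    where
    undo : ∀ p x → + 2 * x ≡ p - (p - + 2 * x)
    undo = solve-∀

  double≢reflect : ∀ {x y} → double x ≢ reflect y
  double≢reflect {x} {y} eq = ℕP.even≢odd ℤ.∣ x + y ∣ h (begin
    2 ℕ.* ℤ.∣ x + y ∣    ≡⟨ ℤP.abs-* (+ 2) (x + y) ⟨
    ℤ.∣ + 2 * (x + y) ∣  ≡⟨ cong ℤ.∣_∣ p≡2[x+y] ⟨
    p                    ≡⟨ p≡1+2h ⟩
    suc (h ℕ.+ h)        ≡⟨ cong (λ n → suc (h ℕ.+ n)) (ℕP.+-identityʳ h) ⟨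
    suc (2 ℕ.* h)        ∎)
    where
    open ≡-Reasoning
    undo : ∀ a b → (a - b) + b ≡ a
    undo = solve-∀
    p≡2[x+y] : + p ≡ + 2 * (x + y)
    p≡2[x+y] = begin
      + p                        ≡⟨ undo (+ p) (+ 2 * y) ⟨
      (+ p - + 2 * y) + + 2 * y  ≡⟨ cong (_+ + 2 * y) eq ⟨
      + 2 * x + + 2 * y          ≡⟨ ℤP.*-distribˡ-+ (+ 2) x y ⟨
      + 2 * (x + y)              ∎

  module _ {s n₁ n₂ c : ℕ} where

    private
      n = n₁ ℕ.+ n₂

    double-∈ : c ≤ 2 ℕ.* s → 2 ℕ.* (s ℕ.+ n₁) ≤ suc (c ℕ.+ n) →
               ∀ {x} → x ∈ range s n₁ → double x ∈ range c n
    double-∈ c≤2s 2[s+n₁]≤ x∈ with m , refl , s≤m , m<s+n₁ ← ∈-range⁻ x∈ =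
      subst (_∈ range c n) (ℤP.pos-* 2 m) (∈-range⁺ c≤2m 2m<c+n)
      where
      c≤2m : c ≤ 2 ℕ.* m
      c≤2m = ℕP.≤-trans c≤2s (ℕP.*-monoʳ-≤ 2 s≤m)
      2m<c+n : 2 ℕ.* m < c ℕ.+ n
      2m<c+n = ℕ.s≤s⁻¹ (subst (_≤ suc (c ℕ.+ n)) (ℕP.*-suc 2 m) (ℕP.≤-trans (ℕP.*-monoʳ-≤ 2 m<s+n₁) 2[s+n₁]≤))

    reflect-∈ : c ℕ.+ 2 ℕ.* (s ℕ.+ n) ≤ 2 ℕ.+ p → p < c ℕ.+ n ℕ.+ 2 ℕ.* (s ℕ.+ n₁) →
                ∀ {x} → x ∈ range (s ℕ.+ n₁) n₂ → reflect x ∈ range c n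
    reflect-∈ c+2[s+n]≤ p< x∈ with m , refl , s+n₁≤m , m<s+n₁+n₂ ← ∈-range⁻ x∈ =
      subst (λ t → + p - t ∈ range c n) (ℤP.pos-* 2 m) (p-∈-range c+2m≤p p<c+n+2m)
      where
      m<s+n : m < s ℕ.+ n
      m<s+n = subst (m <_) (ℕP.+-assoc s n₁ n₂) m<s+n₁+n₂
      c+2m≤p : c ℕ.+ 2 ℕ.* m ≤ p
      c+2m≤p = ℕP.+-cancelˡ-≤ 2 _ _ (begin
        2 ℕ.+ (c ℕ.+ 2 ℕ.* m)    ≡⟨ shift c m ⟩
        c ℕ.+ 2 ℕ.* suc m        ≤⟨ ℕP.+-monoʳ-≤ c (ℕP.*-monoʳ-≤ 2 m<s+n) ⟩
        c ℕ.+ 2 ℕ.* (s ℕ.+ n)    ≤⟨ c+2[s+n]≤ ⟩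
        2 ℕ.+ p                  ∎)
        where
        open ℕP.≤-Reasoning
        shift : ∀ c m → 2 ℕ.+ (c ℕ.+ 2 ℕ.* m) ≡ c ℕ.+ 2 ℕ.* suc m
        shift = ℕSolver.solve-∀
      p<c+n+2m : p < c ℕ.+ n ℕ.+ 2 ℕ.* m
      p<c+n+2m = ℕP.<-≤-trans p< (ℕP.+-monoʳ-≤ (c ℕ.+ n) (ℕP.*-monoʳ-≤ 2 s+n₁≤m))

    -- The inequalities say that doubling maps [s, s + n₁) and x ↦ p - 2x maps [s + n₁, s + n)
    -- into [c, c + n).
    fold-↭ : c ≤ 2 ℕ.* s → 2 ℕ.* (s ℕ.+ n₁) ≤ suc (c ℕ.+ n) →
             c ℕ.+ 2 ℕ.* (s ℕ.+ n) ≤ 2 ℕ.+ p → p < c ℕ.+ n ℕ.+ 2 ℕ.* (s ℕ.+ n₁) →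
             map double (range s n₁) ++ map reflect (range (s ℕ.+ n₁) n₂) ↭ range c n
    fold-↭ c≤2s 2[s+n₁]≤ c+2[s+n]≤ p< =
      unique-⊆-length⇒↭ unique-folds (range-unique c n) folds⊆ (ℕP.≤-reflexive ∣range∣≡∣folds∣)
      where
      unique-folds : Unique (map double (range s n₁) ++ map reflect (range (s ℕ.+ n₁) n₂))
      unique-folds = Unique.++⁺ (Unique.map⁺ double-injective (range-unique s n₁))
                                (Unique.map⁺ reflect-injective (range-unique (s ℕ.+ n₁) n₂))
                                λ (v∈d , v∈r) → disjoint (∈-map⁻ double v∈d) (∈-map⁻ reflect v∈r)
        where
        disjoint : ∀ {v} → (∃ λ x → x ∈ range s n₁ × v ≡ double x) →
                   ¬ (∃ λ y → y ∈ range (s ℕ.+ n₁) n₂ × v ≡ reflect y)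
        disjoint (x , _ , refl) (y , _ , 2x≡p-2y) = double≢reflect {x} {y} 2x≡p-2y
      folds⊆ : ∀ {v} → v ∈ map double (range s n₁) ++ map reflect (range (s ℕ.+ n₁) n₂) → v ∈ range c n
      folds⊆ v∈ with ∈-++⁻ (map double (range s n₁)) v∈
      ... | inj₁ v∈d with x , x∈ , refl ← ∈-map⁻ double v∈d = double-∈ c≤2s 2[s+n₁]≤ x∈
      ... | inj₂ v∈r with x , x∈ , refl ← ∈-map⁻ reflect v∈r = reflect-∈ c+2[s+n]≤ p< x∈
      ∣range∣≡∣folds∣ :
        length (range c n) ≡ length (map double (range s n₁) ++ map reflect (range (s ℕ.+ n₁) n₂))
      ∣range∣≡∣folds∣ = sym (begin
        length (map double (range s n₁) ++ map reflect (range (s ℕ.+ n₁) n₂))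
          ≡⟨ length-++ (map double (range s n₁)) {map reflect (range (s ℕ.+ n₁) n₂)} ⟩
        length (map double (range s n₁)) ℕ.+ length (map reflect (range (s ℕ.+ n₁) n₂))
          ≡⟨ cong₂ ℕ._+_ (trans (length-map double (range s n₁)) (length-range s n₁))
                         (trans (length-map reflect (range (s ℕ.+ n₁) n₂)) (length-range (s ℕ.+ n₁) n₂)) ⟩
        n                  ≡⟨ length-range c n ⟨
        length (range c n) ∎)
        where open ≡-Reasoning

    fold-product : c ≤ 2 ℕ.* s → 2 ℕ.* (s ℕ.+ n₁) ≤ suc (c ℕ.+ n) →
                   c ℕ.+ 2 ℕ.* (s ℕ.+ n) ≤ 2 ℕ.+ p → p < c ℕ.+ n ℕ.+ 2 ℕ.* (s ℕ.+ n₁) →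
                   product (range c n) ≈ -1ℤ ^ n₂ * ((+ 2) ^ n * product (range s n))
    fold-product c≤2s 2[s+n₁]≤ c+2[s+n]≤ p< = begin
      product (range c n)
        ≡⟨ product-↭ (fold-↭ c≤2s 2[s+n₁]≤ c+2[s+n]≤ p<) ⟨
      product (map double D ++ map reflect F)
        ≡⟨ product-++ (map double D) (map reflect F) ⟩
      product (map double D) * product (map reflect F)
        ≈⟨ *-congˡ (product (map double D)) (product-map-≈ F reflect≈) ⟩
      product (map double D) * product (map (λ x → -1ℤ * double x) F)
        ≡⟨ cong (λ xs → product (map double D) * product xs) (map-∘ F) ⟩
      product (map double D) * product (map (-1ℤ *_) (map double F))
        ≡⟨ cong₂ _*_ (product-map-* (+ 2) D) (trans (product-map-* -1ℤ (map double F))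
                                                   (cong₂ _*_ (cong (-1ℤ ^_) (length-map double F))
                                                              (product-map-* (+ 2) F))) ⟩
      (+ 2) ^ length D * product D * (-1ℤ ^ length F * ((+ 2) ^ length F * product F))
        ≡⟨ cong₂ (λ a b → (+ 2) ^ a * product D * (-1ℤ ^ b * ((+ 2) ^ b * product F)))
                 (length-range s n₁) (length-range (s ℕ.+ n₁) n₂) ⟩
      (+ 2) ^ n₁ * product D * (-1ℤ ^ n₂ * ((+ 2) ^ n₂ * product F))
        ≡⟨ regroup ((+ 2) ^ n₁) ((+ 2) ^ n₂) (-1ℤ ^ n₂) (product D) (product F) ⟩
      -1ℤ ^ n₂ * (((+ 2) ^ n₁ * (+ 2) ^ n₂) * (product D * product F))
        ≡⟨ cong₂ (λ a b → -1ℤ ^ n₂ * (a * b)) (ℤP.^-distribˡ-+-* (+ 2) n₁ n₂)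
                 (trans (cong product (range-++ s n₁ n₂)) (product-++ D F)) ⟨
      -1ℤ ^ n₂ * ((+ 2) ^ n * product (range s n)) ∎
      where
      open ≈-Reasoning
      D = range s n₁
      F = range (s ℕ.+ n₁) n₂
      regroup : ∀ a b σ x y → a * x * (σ * (b * y)) ≡ σ * ((a * b) * (x * y))
      regroup = solve-∀
      reflect≈ : ∀ x → reflect x ≈ -1ℤ * double x
      reflect≈ x = ≈-by (+ 1) (shift (+ p) x)
        where
        shift : ∀ p x → (p - + 2 * x) - (- + 1 * (+ 2 * x)) ≡ + 1 * p
        shift = solve-∀

  ∏χ-fold : ∀ {s n₁ n₂ c} →
            c ≤ 2 ℕ.* s → 2 ℕ.* (s ℕ.+ n₁) ≤ suc (c ℕ.+ (n₁ ℕ.+ n₂)) →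
            c ℕ.+ 2 ℕ.* (s ℕ.+ (n₁ ℕ.+ n₂)) ≤ 2 ℕ.+ p → p < c ℕ.+ (n₁ ℕ.+ n₂) ℕ.+ 2 ℕ.* (s ℕ.+ n₁) →
            All Nonzero (range s (n₁ ℕ.+ n₂)) → All Nonzero (range c (n₁ ℕ.+ n₂)) →
            ∏χ (range c (n₁ ℕ.+ n₂)) ≡ (-1ℤ ^ n₂) ^ h * (χ (+ 2) ^ (n₁ ℕ.+ n₂) * ∏χ (range s (n₁ ℕ.+ n₂)))
  ∏χ-fold {s} {n₁} {n₂} {c} c≤2s 2[s+n₁]≤ c+2[s+n]≤ p< B≢0 C≢0 =
    sign-≈⇒≡ (∏χ-sign C≢0)
             (sign-* (sign-^ h (sign-^ n₂ (inj₂ refl))) (sign-* (sign-^ n (χ-sign 2≢0)) (∏χ-sign B≢0)))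
    (begin
      ∏χ C
        ≈⟨ ∏χ-≈ C≢0 ⟩
      product C ^ h
        ≈⟨ ^-cong h (fold-product {s} {n₁} {n₂} {c} c≤2s 2[s+n₁]≤ c+2[s+n]≤ p<) ⟩
      (σ * ((+ 2) ^ n * product B)) ^ h
        ≡⟨ ^-distribʳ-* σ ((+ 2) ^ n * product B) h ⟩
      σ ^ h * ((+ 2) ^ n * product B) ^ h
        ≡⟨ cong (σ ^ h *_) (^-distribʳ-* ((+ 2) ^ n) (product B) h) ⟩
      σ ^ h * (((+ 2) ^ n) ^ h * product B ^ h)
        ≡⟨ cong (λ y → σ ^ h * (y * product B ^ h)) (^-comm (+ 2) n h) ⟩
      σ ^ h * (((+ 2) ^ h) ^ n * product B ^ h)
        ≈⟨ *-congˡ (σ ^ h) (*-cong (^-cong n (≈-sym (euler-criterion 2≢0))) (≈-sym (∏χ-≈ B≢0))) ⟩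
      σ ^ h * (χ (+ 2) ^ n * ∏χ B) ∎)
    where
    open ≈-Reasoning
    n = n₁ ℕ.+ n₂
    B = range s n
    C = range c n
    σ = -1ℤ ^ n₂

  -- Gauss's lemma for 2: fold [1, h], doubling its g₁ elements below p/4.
  second-supplement : ∀ g₁ g₂ → h ≡ g₁ ℕ.+ g₂ → g₁ ≤ g₂ → g₂ ≤ suc g₁ → χ (+ 2) ≡ -1ℤ ^ g₂
  second-supplement g₁ g₂ refl g₁≤g₂ g₂≤1+g₁ = sign-≈⇒≡ (χ-sign 2≢0) ±σ χ[2]≈σ
    where
    σ = -1ℤ ^ g₂
    ±σ : IsSign σ
    ±σ = sign-^ g₂ (inj₂ refl)
    H = range 1 h
    H≢0 : All Nonzero H
    H≢0 = range-nonzero (s≤s z≤n) (ℕP.≤-trans (ℕP.m≤m+n (suc h) h) (1+h+m≤p ℕP.≤-refl))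
    fold : product H ≈ σ * ((+ 2) ^ h * product H)
    fold = fold-product {1} {g₁} {g₂} {1} (s≤s z≤n) d₂ (ℕP.≤-reflexive r₁) r₂
      where
      open ℕP.≤-Reasoning
      d₂ : 2 ℕ.* (1 ℕ.+ g₁) ≤ suc (1 ℕ.+ h)
      d₂ = begin
        2 ℕ.* (1 ℕ.+ g₁)        ≡⟨ ℕSolver.solve (g₁ ∷ []) ⟩
        2 ℕ.+ (g₁ ℕ.+ g₁)       ≤⟨ ℕP.+-monoʳ-≤ 2 (ℕP.+-monoʳ-≤ g₁ g₁≤g₂) ⟩
        2 ℕ.+ (g₁ ℕ.+ g₂)       ∎
      r₁ : 1 ℕ.+ 2 ℕ.* (1 ℕ.+ h) ≡ 2 ℕ.+ p
      r₁ = trans r₁′ (cong (2 ℕ.+_) (sym p≡1+2h))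
        where
        r₁′ : 1 ℕ.+ 2 ℕ.* (1 ℕ.+ h) ≡ 2 ℕ.+ suc (h ℕ.+ h)
        r₁′ = ℕSolver.solve (g₁ ∷ g₂ ∷ [])
      r₂ : p < 1 ℕ.+ h ℕ.+ 2 ℕ.* (1 ℕ.+ g₁)
      r₂ = begin
        suc p                          ≡⟨ cong suc p≡1+2h ⟩
        suc (suc (h ℕ.+ h))            ≡⟨ ℕSolver.solve (g₁ ∷ g₂ ∷ []) ⟩
        2 ℕ.+ h ℕ.+ g₁ ℕ.+ g₂          ≤⟨ ℕP.+-monoʳ-≤ (2 ℕ.+ h ℕ.+ g₁) g₂≤1+g₁ ⟩
        2 ℕ.+ h ℕ.+ g₁ ℕ.+ suc g₁      ≡⟨ ℕSolver.solve (g₁ ∷ g₂ ∷ []) ⟩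
        1 ℕ.+ h ℕ.+ 2 ℕ.* (1 ℕ.+ g₁)   ∎
    σ2^h≈1 : σ * (+ 2) ^ h ≈ 1ℤ
    σ2^h≈1 = cancelʳ (≈-trans (≈-reflexive (ℤP.*-assoc σ ((+ 2) ^ h) (product H)))
                              (≈-trans (≈-sym fold) (≈-reflexive (sym (ℤP.*-identityˡ (product H))))))
                     (product-nonzero H≢0)
    χ[2]≈σ : χ (+ 2) ≈ σ
    χ[2]≈σ = begin
      χ (+ 2)           ≈⟨ euler-criterion 2≢0 ⟩
      (+ 2) ^ h                  ≡⟨ ℤP.*-identityˡ ((+ 2) ^ h) ⟨
      1ℤ * (+ 2) ^ h             ≡⟨ cong (_* (+ 2) ^ h) (sign-square ±σ) ⟨
      σ * σ * (+ 2) ^ h          ≡⟨ ℤP.*-assoc σ σ ((+ 2) ^ h) ⟩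
      σ * (σ * (+ 2) ^ h)        ≈⟨ *-congˡ σ σ2^h≈1 ⟩
      σ * 1ℤ                     ≡⟨ ℤP.*-identityʳ σ ⟩
      σ                          ∎
      where open ≈-Reasoning

  reflection-↭ : map (λ x → + p - x) (range 1 h) ↭ range (suc h) h
  reflection-↭ = unique-⊆-length⇒↭ (Unique.map⁺ p-injective (range-unique 1 h)) (range-unique (suc h) h)
                   reflections⊆ (ℕP.≤-reflexive (trans (length-range (suc h) h)
                                  (sym (trans (length-map (λ x → + p - x) (range 1 h)) (length-range 1 h)))))
    where
    undo : ∀ p x → x ≡ p - (p - x)
    undo = solve-∀
    p-injective : ∀ {x y} → + p - x ≡ + p - y → x ≡ y
    p-injective {x} {y} eq = trans (undo (+ p) x) (trans (cong (λ t → + p - t) eq) (sym (undo (+ p) y)))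
    reflections⊆ : ∀ {v} → v ∈ map (λ x → + p - x) (range 1 h) → v ∈ range (suc h) h
    reflections⊆ v∈ with x , x∈ , refl ← ∈-map⁻ (λ x → + p - x) v∈
                    with m , refl , 1≤m , m<1+h ← ∈-range⁻ x∈ =
      p-∈-range {suc h} {h} {m} (1+h+m≤p (ℕ.s≤s⁻¹ m<1+h))
        (subst (_< suc h ℕ.+ h ℕ.+ m) (sym p≡1+2h) (s≤s (ℕP.m<m+n (h ℕ.+ h) 1≤m)))

  -- x ↦ p - x maps [1, h] onto [h + 1, 2h], so Wilson's theorem reads (h!)² ≡ (-1)^(h+1).
  ∏χ-first-half : ∀ m → h ≡ m ℕ.+ m → ∏χ (range 1 h) ≡ -1ℤ ^ m
  ∏χ-first-half m refl = sign-≈⇒≡ (∏χ-sign H≢0) (sign-^ m (inj₂ refl)) (begin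
    ∏χ H   ≈⟨ ∏χ-≈ H≢0 ⟩
    P ^ (m ℕ.+ m)                  ≡⟨ ℤP.^-distribˡ-+-* P m m ⟩
    P ^ m * P ^ m                  ≡⟨ ^-distribʳ-* P P m ⟨
    (P * P) ^ m                    ≈⟨ ^-cong m P²≈-1 ⟩
    -1ℤ ^ m                        ∎)
    where
    open ≈-Reasoning
    H = range 1 h
    P = product H
    H≢0 : All Nonzero H
    H≢0 = range-nonzero (s≤s z≤n) (ℕP.≤-trans (ℕP.m≤m+n (suc h) h) (1+h+m≤p ℕP.≤-refl))
    upper-half : product (range (suc h) h) ≈ P
    upper-half = begin
      product (range (suc h) h)              ≡⟨ product-↭ reflection-↭ ⟨
      product (map (λ x → + p - x) H)        ≈⟨ product-map-≈ H (λ x → ≈-by (+ 1) (shift (+ p) x)) ⟩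
      product (map (-1ℤ *_) H)               ≡⟨ product-map-* -1ℤ H ⟩
      -1ℤ ^ length H * P                     ≡⟨ cong (λ n → -1ℤ ^ n * P) (length-range 1 h) ⟩
      -1ℤ ^ h * P                            ≡⟨ cong (_* P) (sign-^-even m (inj₂ refl)) ⟩
      1ℤ * P                                 ≡⟨ ℤP.*-identityˡ P ⟩
      P                                      ∎
      where
      shift : ∀ p x → (p - x) - -1ℤ * x ≡ + 1 * p
      shift = solve-∀
    P²≈-1 : P * P ≈ -1ℤ
    P²≈-1 = begin
      P * P                                  ≈⟨ *-congˡ P upper-half ⟨
      P * product (range (suc h) h)          ≡⟨ product-++ H (range (suc h) h) ⟨
      product (H ++ range (suc h) h)         ≡⟨ cong product (range-++ 1 h h) ⟨
      product U                              ≈⟨ wilson ⟩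
      -1ℤ                                    ∎

-- The intervals (0, p/3), (p/6, p/3) and (p/3, p/2)

-- b = ⌊p/6⌋ and b + n = ⌊p/3⌋, with remainders r₆ and 1 + r₃; then h = b + 2n, and B and C
-- both have n elements.
module Intervals (p h : ℕ) (p≡1+2h : p ≡ suc (h ℕ.+ h)) (prime : Prime p) (6<p : 6 < p)
              (b n r₆ r₃ : ℕ) (h≡b+2n : h ≡ b ℕ.+ (n ℕ.+ n))
              (p≡r₆+6b : p ≡ r₆ ℕ.+ b ℕ.* 6) (r₆<6 : r₆ < 6)
              (p≡1+r₃+3[b+n] : p ≡ suc r₃ ℕ.+ (b ℕ.+ n) ℕ.* 3) (1+r₃<3 : suc r₃ < 3) where

  open Folding p h p≡1+2h prime public

  private
    3<p : 3 < p
    3<p = ℕP.≤-trans (ℕP.m≤m+n 4 3) 6<p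
    p≡1+h*2 : p ≡ 1 ℕ.+ h ℕ.* 2
    p≡1+h*2 = trans p≡1+2h (cong suc (trans (cong (h ℕ.+_) (sym (ℕP.+-identityʳ h))) (ℕP.*-comm 2 h)))
    h≡b+n+n : h ≡ (b ℕ.+ n) ℕ.+ n
    h≡b+n+n = trans h≡b+2n (sym (ℕP.+-assoc b n n))

  B C A₀ : List ℤ
  B  = range (suc b) n
  C  = range (suc (b ℕ.+ n)) n
  A₀ = range 1 b

  B≡ : intsBetween (+ p / 6) (+ p / 3) ≡ B
  B≡ = intsBetween≡range {+ p / 6} {+ p / 3} b n (floor-/ (prime⇒coprime prime 6<p) p≡r₆+6b r₆<6)
                             (ceiling-/ (prime⇒coprime prime 3<p) p≡1+r₃+3[b+n] 1+r₃<3)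

  C≡ : intsBetween (+ p / 3) (+ p / 2) ≡ C
  C≡ = intsBetween≡range {+ p / 3} {+ p / 2} (b ℕ.+ n) n
         (floor-/ (prime⇒coprime prime 3<p) p≡1+r₃+3[b+n] 1+r₃<3)
         (trans (ceiling-/ (prime⇒coprime prime 2<p) p≡1+h*2 (ℕP.n<1+n 1)) (cong (λ m → + suc m) h≡b+n+n))

  A≡ : intsBetween (+ 0 / 1) (+ p / 3) ≡ A₀ ++ B
  A≡ = trans (intsBetween≡range {+ 0 / 1} {+ p / 3} 0 (b ℕ.+ n) refl
               (ceiling-/ (prime⇒coprime prime 3<p) p≡1+r₃+3[b+n] 1+r₃<3))
             (range-++ 1 b n)

  H≡ : range 1 h ≡ A₀ ++ B ++ C
  H≡ = trans (cong (range 1) h≡b+n+n)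
         (trans (range-++ 1 (b ℕ.+ n) n) (trans (cong (_++ C) (range-++ 1 b n)) (++-assoc A₀ B C)))

  private
    C-bound : suc (b ℕ.+ n) ℕ.+ n ≤ p
    C-bound = subst (suc (b ℕ.+ n) ℕ.+ n ≤_) (sym p≡1+2h) (s≤s (subst (_≤ h ℕ.+ h) h≡b+n+n (ℕP.m≤m+n h h)))

  B≢0 : All Nonzero B
  B≢0 = range-nonzero (s≤s z≤n) (ℕP.≤-trans (ℕP.+-monoˡ-≤ n (s≤s (ℕP.m≤m+n b n))) C-bound)

  C≢0 : All Nonzero C
  C≢0 = range-nonzero (s≤s z≤n) C-bound

  A≢0 : All Nonzero (A₀ ++ B)
  A≢0 = subst (All Nonzero) (range-++ 1 b n)
          (range-nonzero (s≤s z≤n) (ℕP.≤-trans (s≤s (ℕP.m≤m+n (b ℕ.+ n) n)) C-bound))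

  count-nonresidues : -1ℤ ^ #N3 p ≡ legProd p (+ p / 6) (+ p / 3)
  count-nonresidues = subst (λ xs → -1ℤ ^ length (filterᵇ (λ x → does (χ x ℤ.≟ -1ℤ)) xs) ≡ ∏χ xs)
                            (sym B≡) (sign-count χ B (All.map χ-sign B≢0))

  -- n₁ elements of B lie below p/4, and g₂ = h - ⌊h/2⌋; the four inequalities are those of
  -- fold-↭ for folding B onto C.
  ∏χC≡ : ∀ n₁ n₂ g₁ g₂ → n ≡ n₁ ℕ.+ n₂ →
    suc (b ℕ.+ n) ≤ 2 ℕ.* suc b → 2 ℕ.* (suc b ℕ.+ n₁) ≤ suc (suc (b ℕ.+ n) ℕ.+ n) →
    suc (b ℕ.+ n) ℕ.+ 2 ℕ.* (suc b ℕ.+ n) ≤ 2 ℕ.+ suc (h ℕ.+ h) →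
    suc (h ℕ.+ h) < suc (b ℕ.+ n) ℕ.+ n ℕ.+ 2 ℕ.* (suc b ℕ.+ n₁) →
    h ≡ g₁ ℕ.+ g₂ → g₁ ≤ g₂ → g₂ ≤ suc g₁ →
    ∏χ C ≡ -1ℤ ^ (n₂ ℕ.* h ℕ.+ g₂ ℕ.* n) * ∏χ B
  ∏χC≡ n₁ n₂ g₁ g₂ refl d₁ d₂ r₁ r₂ h≡ g₁≤g₂ g₂≤1+g₁ = begin
    ∏χ C
      ≡⟨ ∏χ-fold d₁ d₂ (subst (λ q → _ ≤ 2 ℕ.+ q) (sym p≡1+2h) r₁) (subst (_< _) (sym p≡1+2h) r₂) B≢0 C≢0 ⟩
    (-1ℤ ^ n₂) ^ h * (χ (+ 2) ^ n * LB)
      ≡⟨ cong (λ c → (-1ℤ ^ n₂) ^ h * (c ^ n * LB)) (second-supplement g₁ g₂ h≡ g₁≤g₂ g₂≤1+g₁) ⟩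
    (-1ℤ ^ n₂) ^ h * ((-1ℤ ^ g₂) ^ n * LB)
      ≡⟨ cong₂ (λ x y → x * (y * LB)) (ℤP.^-*-assoc -1ℤ n₂ h) (ℤP.^-*-assoc -1ℤ g₂ n) ⟩
    -1ℤ ^ (n₂ ℕ.* h) * (-1ℤ ^ (g₂ ℕ.* n) * LB)
      ≡⟨ ℤP.*-assoc (-1ℤ ^ (n₂ ℕ.* h)) (-1ℤ ^ (g₂ ℕ.* n)) LB ⟨
    -1ℤ ^ (n₂ ℕ.* h) * -1ℤ ^ (g₂ ℕ.* n) * LB
      ≡⟨ cong (_* LB) (ℤP.^-distribˡ-+-* -1ℤ (n₂ ℕ.* h) (g₂ ℕ.* n)) ⟨
    -1ℤ ^ (n₂ ℕ.* h ℕ.+ g₂ ℕ.* n) * LB ∎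
    where
    open ≡-Reasoning
    LB = ∏χ B

  ∏χA*∏χC≡ : ∀ m → h ≡ m ℕ.+ m →
    ∏χ (A₀ ++ B) * ∏χ C ≡ -1ℤ ^ m
  ∏χA*∏χC≡ m h≡2m = begin
    ∏χ (A₀ ++ B) * ∏χ C
      ≡⟨ product-++ (map χ (A₀ ++ B)) (map χ C) ⟨
    product (map χ (A₀ ++ B) ++ map χ C)
      ≡⟨ cong product (map-++ χ (A₀ ++ B) C) ⟨
    ∏χ ((A₀ ++ B) ++ C)
      ≡⟨ cong (λ xs → ∏χ xs) (trans (++-assoc A₀ B C) (sym H≡)) ⟩
    ∏χ (range 1 h)
      ≡⟨ ∏χ-first-half m h≡2m ⟩
    -1ℤ ^ m ∎
    where open ≡-Reasoning

-- The four residue classes of p modulo 12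

≤-by : ∀ {m n} d → m ℕ.+ d ≡ n → m ≤ n
≤-by {m} d refl = ℕP.m≤m+n m d

-- p = 12k + 13: B = [2k + 3, 4k + 4] and C = [4k + 5, 6k + 6].
module Residue1 (p k : ℕ) (p≡ : p ≡ suc ((6 ℕ.* k ℕ.+ 6) ℕ.+ (6 ℕ.* k ℕ.+ 6))) (prime : Prime p) (6<p : 6 < p)
  where

  open Intervals p (6 ℕ.* k ℕ.+ 6) p≡ prime 6<p (2 ℕ.* k ℕ.+ 2) (2 ℕ.* k ℕ.+ 2) 1 0
         (ℕSolver.solve (k ∷ [])) (trans p≡ (ℕSolver.solve (k ∷ []))) (s≤s (s≤s z≤n))
         (trans p≡ (ℕSolver.solve (k ∷ []))) (s≤s (s≤s z≤n)) public

  χ[2] : χ (+ 2) ≡ -1ℤ ^ (3 ℕ.* k ℕ.+ 3)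
  χ[2] = second-supplement (3 ℕ.* k ℕ.+ 3) (3 ℕ.* k ℕ.+ 3) (ℕSolver.solve (k ∷ []))
           (≤-by 0 (ℕSolver.solve (k ∷ []))) (≤-by 1 (ℕSolver.solve (k ∷ [])))

  ∏χC≡∏χB : ∏χ C ≡ ∏χ B
  ∏χC≡∏χB = trans (∏χC≡ (suc k) (suc k) (3 ℕ.* k ℕ.+ 3) (3 ℕ.* k ℕ.+ 3) (ℕSolver.solve (k ∷ []))
                     (≤-by 1 (ℕSolver.solve (k ∷ []))) (≤-by 0 (ℕSolver.solve (k ∷ [])))
                     (≤-by 0 (ℕSolver.solve (k ∷ []))) (≤-by 1 (ℕSolver.solve (k ∷ [])))
                     (ℕSolver.solve (k ∷ [])) (≤-by 0 (ℕSolver.solve (k ∷ []))) (≤-by 1 (ℕSolver.solve (k ∷ []))))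
                  (trans (cong (_* ∏χ B) (-1^-parity 0 (6 ℕ.* k ℕ.* k ℕ.+ 12 ℕ.* k ℕ.+ 6) exponent))
                         (ℤP.*-identityˡ (∏χ B)))
    where
    exponent : suc k ℕ.* (6 ℕ.* k ℕ.+ 6) ℕ.+ (3 ℕ.* k ℕ.+ 3) ℕ.* (2 ℕ.* k ℕ.+ 2)
             ≡ 0 ℕ.+ ((6 ℕ.* k ℕ.* k ℕ.+ 12 ℕ.* k ℕ.+ 6) ℕ.+ (6 ℕ.* k ℕ.* k ℕ.+ 12 ℕ.* k ℕ.+ 6))
    exponent = ℕSolver.solve (k ∷ [])

  B≡χ[2]A : legProd p (+ p / 6) (+ p / 3) ≡ χ (+ 2) * legProd p (+ 0 / 1) (+ p / 3)
  B≡χ[2]A = begin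
    legProd p (+ p / 6) (+ p / 3)   ≡⟨ cong ∏χ B≡ ⟩
    ∏χ B                            ≡⟨ sign-flip (∏χ-sign A≢0) ∏χA*∏χB≡χ[2] ⟩
    ∏χ (A₀ ++ B) * χ (+ 2)          ≡⟨ ℤP.*-comm (∏χ (A₀ ++ B)) (χ (+ 2)) ⟩
    χ (+ 2) * ∏χ (A₀ ++ B)          ≡⟨ cong (λ xs → χ (+ 2) * ∏χ xs) A≡ ⟨
    χ (+ 2) * legProd p (+ 0 / 1) (+ p / 3) ∎
    where
    open ≡-Reasoning
    ∏χA*∏χB≡χ[2] : ∏χ (A₀ ++ B) * ∏χ B ≡ χ (+ 2)
    ∏χA*∏χB≡χ[2] = begin
      ∏χ (A₀ ++ B) * ∏χ B     ≡⟨ cong (∏χ (A₀ ++ B) *_) ∏χC≡∏χB ⟨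
      ∏χ (A₀ ++ B) * ∏χ C     ≡⟨ ∏χA*∏χC≡ (3 ℕ.* k ℕ.+ 3) (ℕSolver.solve (k ∷ [])) ⟩
      -1ℤ ^ (3 ℕ.* k ℕ.+ 3)   ≡⟨ χ[2] ⟨
      χ (+ 2)                 ∎

-- p = 12k + 5: B = [2k + 1, 4k + 1] and C = [4k + 2, 6k + 2].
module Residue5 (p k : ℕ) (p≡ : p ≡ suc ((6 ℕ.* k ℕ.+ 2) ℕ.+ (6 ℕ.* k ℕ.+ 2))) (prime : Prime p) (6<p : 6 < p)
  where

  open Intervals p (6 ℕ.* k ℕ.+ 2) p≡ prime 6<p (2 ℕ.* k) (2 ℕ.* k ℕ.+ 1) 5 1
         (ℕSolver.solve (k ∷ [])) (trans p≡ (ℕSolver.solve (k ∷ []))) (ℕP.n<1+n 5)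
         (trans p≡ (ℕSolver.solve (k ∷ []))) (ℕP.n<1+n 2) public

  σ : ℤ
  σ = -1ℤ ^ suc k

  ∏χC≡σ∏χB : ∏χ C ≡ σ * ∏χ B
  ∏χC≡σ∏χB = trans (∏χC≡ (suc k) k (3 ℕ.* k ℕ.+ 1) (3 ℕ.* k ℕ.+ 1) (ℕSolver.solve (k ∷ []))
                      (≤-by 0 (ℕSolver.solve (k ∷ []))) (≤-by 0 (ℕSolver.solve (k ∷ [])))
                      (≤-by 1 (ℕSolver.solve (k ∷ []))) (≤-by 1 (ℕSolver.solve (k ∷ [])))
                      (ℕSolver.solve (k ∷ [])) (≤-by 0 (ℕSolver.solve (k ∷ []))) (≤-by 1 (ℕSolver.solve (k ∷ []))))
                   (cong (_* ∏χ B) (-1^-parity (suc k) (6 ℕ.* k ℕ.* k ℕ.+ 3 ℕ.* k) exponent))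
    where
    exponent : k ℕ.* (6 ℕ.* k ℕ.+ 2) ℕ.+ (3 ℕ.* k ℕ.+ 1) ℕ.* (2 ℕ.* k ℕ.+ 1)
             ≡ suc k ℕ.+ ((6 ℕ.* k ℕ.* k ℕ.+ 3 ℕ.* k) ℕ.+ (6 ℕ.* k ℕ.* k ℕ.+ 3 ℕ.* k))
    exponent = ℕSolver.solve (k ∷ [])

  B≡A : legProd p (+ p / 6) (+ p / 3) ≡ legProd p (+ 0 / 1) (+ p / 3)
  B≡A = begin
    legProd p (+ p / 6) (+ p / 3)  ≡⟨ cong ∏χ B≡ ⟩
    ∏χ B                           ≡⟨ sign-flip (∏χ-sign A≢0) ∏χA*∏χB≡1 ⟩
    ∏χ (A₀ ++ B) * 1ℤ              ≡⟨ ℤP.*-identityʳ (∏χ (A₀ ++ B)) ⟩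
    ∏χ (A₀ ++ B)                   ≡⟨ cong ∏χ A≡ ⟨
    legProd p (+ 0 / 1) (+ p / 3)  ∎
    where
    open ≡-Reasoning
    ±σ : IsSign σ
    ±σ = sign-^ (suc k) (inj₂ refl)
    swap : ∀ a b c → a * (b * c) ≡ b * (a * c)
    swap = solve-∀
    ∏χA*∏χB≡1 : ∏χ (A₀ ++ B) * ∏χ B ≡ 1ℤ
    ∏χA*∏χB≡1 = trans (sign-flip ±σ (begin
      σ * (∏χ (A₀ ++ B) * ∏χ B)   ≡⟨ swap σ (∏χ (A₀ ++ B)) (∏χ B) ⟩
      ∏χ (A₀ ++ B) * (σ * ∏χ B)   ≡⟨ cong (∏χ (A₀ ++ B) *_) ∏χC≡σ∏χB ⟨
      ∏χ (A₀ ++ B) * ∏χ C         ≡⟨ ∏χA*∏χC≡ (3 ℕ.* k ℕ.+ 1) (ℕSolver.solve (k ∷ [])) ⟩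
      -1ℤ ^ (3 ℕ.* k ℕ.+ 1)       ≡⟨ -1^-parity {3 ℕ.* k ℕ.+ 1} (suc k) k (ℕSolver.solve (k ∷ [])) ⟩
      σ                           ∎)) (sign-square ±σ)

-- p = 12k + 7: B = [2k + 2, 4k + 2] and C = [4k + 3, 6k + 3].
module Residue7 (p k : ℕ) (p≡ : p ≡ suc ((6 ℕ.* k ℕ.+ 3) ℕ.+ (6 ℕ.* k ℕ.+ 3))) (prime : Prime p) (6<p : 6 < p)
  where

  open Intervals p (6 ℕ.* k ℕ.+ 3) p≡ prime 6<p (2 ℕ.* k ℕ.+ 1) (2 ℕ.* k ℕ.+ 1) 1 0
         (ℕSolver.solve (k ∷ [])) (trans p≡ (ℕSolver.solve (k ∷ []))) (s≤s (s≤s z≤n))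
         (trans p≡ (ℕSolver.solve (k ∷ []))) (s≤s (s≤s z≤n)) public

  ∏χC≡-∏χB : ∏χ C ≡ -1ℤ * ∏χ B
  ∏χC≡-∏χB = trans (∏χC≡ k (suc k) (3 ℕ.* k ℕ.+ 1) (3 ℕ.* k ℕ.+ 2) (ℕSolver.solve (k ∷ []))
                      (≤-by 1 (ℕSolver.solve (k ∷ []))) (≤-by 1 (ℕSolver.solve (k ∷ [])))
                      (≤-by 0 (ℕSolver.solve (k ∷ []))) (≤-by 0 (ℕSolver.solve (k ∷ [])))
                      (ℕSolver.solve (k ∷ [])) (≤-by 1 (ℕSolver.solve (k ∷ []))) (≤-by 0 (ℕSolver.solve (k ∷ []))))
                   (cong (_* ∏χ B) (-1^-parity 1 (6 ℕ.* k ℕ.* k ℕ.+ 8 ℕ.* k ℕ.+ 2) exponent))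
    where
    exponent : suc k ℕ.* (6 ℕ.* k ℕ.+ 3) ℕ.+ (3 ℕ.* k ℕ.+ 2) ℕ.* (2 ℕ.* k ℕ.+ 1)
             ≡ 1 ℕ.+ ((6 ℕ.* k ℕ.* k ℕ.+ 8 ℕ.* k ℕ.+ 2) ℕ.+ (6 ℕ.* k ℕ.* k ℕ.+ 8 ℕ.* k ℕ.+ 2))
    exponent = ℕSolver.solve (k ∷ [])

  B≡-C : legProd p (+ p / 6) (+ p / 3) ≡ - legProd p (+ p / 3) (+ p / 2)
  B≡-C = begin
    legProd p (+ p / 6) (+ p / 3)    ≡⟨ cong ∏χ B≡ ⟩
    ∏χ B                             ≡⟨ sign-flip (inj₂ refl) (sym ∏χC≡-∏χB) ⟩
    -1ℤ * ∏χ C                       ≡⟨ ℤP.-1*i≡-i (∏χ C) ⟩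
    - ∏χ C                           ≡⟨ cong (λ xs → - ∏χ xs) C≡ ⟨
    - legProd p (+ p / 3) (+ p / 2)  ∎
    where open ≡-Reasoning

-- p = 12k + 11: B = [2k + 2, 4k + 3] and C = [4k + 4, 6k + 5].
module Residue11 (p k : ℕ) (p≡ : p ≡ suc ((6 ℕ.* k ℕ.+ 5) ℕ.+ (6 ℕ.* k ℕ.+ 5))) (prime : Prime p) (6<p : 6 < p)
  where

  open Intervals p (6 ℕ.* k ℕ.+ 5) p≡ prime 6<p (2 ℕ.* k ℕ.+ 1) (2 ℕ.* k ℕ.+ 2) 5 1
         (ℕSolver.solve (k ∷ [])) (trans p≡ (ℕSolver.solve (k ∷ []))) (ℕP.n<1+n 5)
         (trans p≡ (ℕSolver.solve (k ∷ []))) (ℕP.n<1+n 2) public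

  σ : ℤ
  σ = -1ℤ ^ suc k

  χ[2]≡σ : χ (+ 2) ≡ σ
  χ[2]≡σ = trans (second-supplement (3 ℕ.* k ℕ.+ 2) (3 ℕ.* k ℕ.+ 3) (ℕSolver.solve (k ∷ []))
                    (≤-by 1 (ℕSolver.solve (k ∷ []))) (≤-by 0 (ℕSolver.solve (k ∷ []))))
                 (-1^-parity {3 ℕ.* k ℕ.+ 3} (suc k) (suc k) (ℕSolver.solve (k ∷ [])))

  ∏χC≡σ∏χB : ∏χ C ≡ σ * ∏χ B
  ∏χC≡σ∏χB = trans (∏χC≡ (suc k) (suc k) (3 ℕ.* k ℕ.+ 2) (3 ℕ.* k ℕ.+ 3) (ℕSolver.solve (k ∷ []))
                      (≤-by 0 (ℕSolver.solve (k ∷ []))) (≤-by 1 (ℕSolver.solve (k ∷ [])))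
                      (≤-by 1 (ℕSolver.solve (k ∷ []))) (≤-by 0 (ℕSolver.solve (k ∷ [])))
                      (ℕSolver.solve (k ∷ [])) (≤-by 1 (ℕSolver.solve (k ∷ []))) (≤-by 0 (ℕSolver.solve (k ∷ []))))
                   (cong (_* ∏χ B) (-1^-parity (suc k) (6 ℕ.* k ℕ.* k ℕ.+ 11 ℕ.* k ℕ.+ 5) exponent))
    where
    exponent : suc k ℕ.* (6 ℕ.* k ℕ.+ 5) ℕ.+ (3 ℕ.* k ℕ.+ 3) ℕ.* (2 ℕ.* k ℕ.+ 2)
             ≡ suc k ℕ.+ ((6 ℕ.* k ℕ.* k ℕ.+ 11 ℕ.* k ℕ.+ 5) ℕ.+ (6 ℕ.* k ℕ.* k ℕ.+ 11 ℕ.* k ℕ.+ 5))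
    exponent = ℕSolver.solve (k ∷ [])

  B≡χ[2]C : legProd p (+ p / 6) (+ p / 3) ≡ χ (+ 2) * legProd p (+ p / 3) (+ p / 2)
  B≡χ[2]C = begin
    legProd p (+ p / 6) (+ p / 3)            ≡⟨ cong ∏χ B≡ ⟩
    ∏χ B                                     ≡⟨ sign-flip (sign-^ (suc k) (inj₂ refl)) (sym ∏χC≡σ∏χB) ⟩
    σ * ∏χ C                                 ≡⟨ cong₂ _*_ χ[2]≡σ (cong ∏χ C≡) ⟨
    χ (+ 2) * legProd p (+ p / 3) (+ p / 2)  ∎
    where open ≡-Reasoning

data Residue12 (p : ℕ) : Set where
  r1  : ∀ k → p ≡ suc ((6 ℕ.* k ℕ.+ 6) ℕ.+ (6 ℕ.* k ℕ.+ 6)) → Residue12 p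
  r5  : ∀ k → p ≡ suc ((6 ℕ.* k ℕ.+ 2) ℕ.+ (6 ℕ.* k ℕ.+ 2)) → Residue12 p
  r7  : ∀ k → p ≡ suc ((6 ℕ.* k ℕ.+ 3) ℕ.+ (6 ℕ.* k ℕ.+ 3)) → Residue12 p
  r11 : ∀ k → p ≡ suc ((6 ℕ.* k ℕ.+ 5) ℕ.+ (6 ℕ.* k ℕ.+ 5)) → Residue12 p

prime-mod-12 : ∀ p → Prime p → 10 < p → Residue12 p
prime-mod-12 p p-prime 10<p = by-residue (p % 12) (p ℕ./ 12) (ℕDM.m≡m%n+[m/n]*n p 12) (ℕDM.m%n<n p 12)
  where
  impossible : ∀ d .{{_ : ℕ.NonZero d}} → 1 < d → d < p → ∀ q → p ≡ q ℕ.* d → ∀ {A : Set} → A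
  impossible d 1<d d<p q p≡qd with prime⇒coprime p-prime d<p (ℕDiv.divides q p≡qd , ℕDiv.∣-refl)
  ... | d≡1 = ⊥-elim (ℕP.<-irrefl (sym d≡1) 1<d)
  2<p : 2 < p
  2<p = ℕP.≤-trans (ℕP.m≤m+n 3 8) 10<p
  3<p : 3 < p
  3<p = ℕP.≤-trans (ℕP.m≤m+n 4 7) 10<p
  even : ∀ j k → p ≡ (j ℕ.+ j) ℕ.+ k ℕ.* 12 → Residue12 p
  even j k eq = impossible 2 (ℕP.n<1+n 1) 2<p (j ℕ.+ 6 ℕ.* k) (trans eq (ℕSolver.solve (j ∷ k ∷ [])))
  triple : ∀ j k → p ≡ (j ℕ.+ j ℕ.+ j) ℕ.+ k ℕ.* 12 → Residue12 p
  triple j k eq = impossible 3 (s≤s (s≤s z≤n)) 3<p (j ℕ.+ 4 ℕ.* k) (trans eq (ℕSolver.solve (j ∷ k ∷ [])))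
  by-residue : ∀ r k → p ≡ r ℕ.+ k ℕ.* 12 → r < 12 → Residue12 p
  by-residue 0  k eq _ = even 0 k eq
  by-residue 1  zero    refl _ = ⊥-elim (ℕP.<⇒≱ 10<p (s≤s z≤n))
  by-residue 1  (suc k) eq _ = r1 k (trans eq (ℕSolver.solve (k ∷ [])))
  by-residue 2  k eq _ = even 1 k eq
  by-residue 3  k eq _ = triple 1 k eq
  by-residue 4  k eq _ = even 2 k eq
  by-residue 5  k eq _ = r5 k (trans eq (ℕSolver.solve (k ∷ [])))
  by-residue 6  k eq _ = even 3 k eq
  by-residue 7  k eq _ = r7 k (trans eq (ℕSolver.solve (k ∷ [])))
  by-residue 8  k eq _ = even 4 k eq
  by-residue 9  k eq _ = triple 3 k eq
  by-residue 10 k eq _ = even 5 k eq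
  by-residue 11 k eq _ = r11 k (trans eq (ℕSolver.solve (k ∷ [])))
  by-residue (suc (suc (suc (suc (suc (suc (suc (suc (suc (suc (suc (suc r)))))))))))) _ _ r<12 =
    ⊥-elim (ℕP.<⇒≱ r<12 (ℕP.m≤m+n 12 r))

residue-of : ∀ {p} → Residue12 p → ℕ
residue-of (r1 _ _)  = 1
residue-of (r5 _ _)  = 5
residue-of (r7 _ _)  = 7
residue-of (r11 _ _) = 11

residue-form : ∀ {n} r k → n ≡ r ℕ.+ k ℕ.* 12 → r < 12 → n % 12 ≡ r
residue-form r k refl r<12 = trans (ℕDM.[m+kn]%n≡m%n r k 12) (ℕDM.m<n⇒m%n≡m r<12)

residue-% : ∀ {p} (s : Residue12 p) → p % 12 ≡ residue-of s
residue-% (r1 k p≡)  = residue-form 1 (suc k) (trans p≡ (ℕSolver.solve (k ∷ []))) (ℕP.m≤m+n 2 10)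
residue-% (r5 k p≡)  = residue-form 5 k (trans p≡ (ℕSolver.solve (k ∷ []))) (ℕP.m≤m+n 6 6)
residue-% (r7 k p≡)  = residue-form 7 k (trans p≡ (ℕSolver.solve (k ∷ []))) (ℕP.m≤m+n 8 4)
residue-% (r11 k p≡) = residue-form 11 k (trans p≡ (ℕSolver.solve (k ∷ []))) (ℕP.n<1+n 11)

wrong-residue : ∀ {p r} {A : Set} (s : Residue12 p) → residue-of s ≢ r → p % 12 ≡ r → A
wrong-residue s s≢r p%12≡r = ⊥-elim (s≢r (trans (sym (residue-% s)) p%12≡r))

theorem4p10 : (p : ℕ) → Prime p → 10 < p →
    ((- (+ 1)) ^ #N3 p ≡ legProd p (+ p / 6) (+ p / 3))
    × (p % 12 ≡ 1 → legProd p (+ p / 6) (+ p / 3) ≡ legendre p (+ 2) * legProd p (+ 0 / 1) (+ p / 3))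
    × (p % 12 ≡ 5 → legProd p (+ p / 6) (+ p / 3) ≡ legProd p (+ 0 / 1) (+ p / 3))
    × (p % 12 ≡ 7 → legProd p (+ p / 6) (+ p / 3) ≡ - legProd p (+ p / 3) (+ p / 2))
    × (p % 12 ≡ 11 → legProd p (+ p / 6) (+ p / 3) ≡ legendre p (+ 2) * legProd p (+ p / 3) (+ p / 2))
theorem4p10 p p-prime 10<p with prime-mod-12 p p-prime 10<p | ℕP.≤-trans (ℕP.m≤m+n 7 4) 10<p
... | r1 k p≡  | 6<p = Residue1.count-nonresidues p k p≡ p-prime 6<p
                      , (λ _ → Residue1.B≡χ[2]A p k p≡ p-prime 6<p)
                      , wrong-residue (r1 k p≡) (λ ()) , wrong-residue (r1 k p≡) (λ ())
                      , wrong-residue (r1 k p≡) (λ ())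
... | r5 k p≡  | 6<p = Residue5.count-nonresidues p k p≡ p-prime 6<p
                      , wrong-residue (r5 k p≡) (λ ()) , (λ _ → Residue5.B≡A p k p≡ p-prime 6<p)
                      , wrong-residue (r5 k p≡) (λ ()) , wrong-residue (r5 k p≡) (λ ())
... | r7 k p≡  | 6<p = Residue7.count-nonresidues p k p≡ p-prime 6<p
                      , wrong-residue (r7 k p≡) (λ ()) , wrong-residue (r7 k p≡) (λ ())
                      , (λ _ → Residue7.B≡-C p k p≡ p-prime 6<p) , wrong-residue (r7 k p≡) (λ ())
... | r11 k p≡ | 6<p = Residue11.count-nonresidues p k p≡ p-prime 6<p
                      , wrong-residue (r11 k p≡) (λ ()) , wrong-residue (r11 k p≡) (λ ())
                      , wrong-residue (r11 k p≡) (λ ()) , (λ _ → Residue11.B≡χ[2]C p k p≡ p-prime 6<p)
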